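{- Let $r\ge 3$ and $2\le k\le r-1$ be integers. Then $$\eta_{r}(1,k)=\sum_{i=1}^{k}(-1)^{i+1}\binom{k+1}{k+1-i}\Bigl(\frac{k+1-i}{k+1}\Bigr)^{r}.$$
   Context: For integers $n,a\ge 1$, $r\ge 3$ and $2\le k\le r-1$, let $\mathcal{L}^{r}_{n,a,k}$ be the family of $r$-uniform hypergraphs $H$ on $n$ vertices whose vertex set admits a partition $V(H)=V_{1}\cup\cdots\cup V_{a}$ with $V_{a}=U_{0}\cup U_{1}\cup\cdots\cup U_{k}$ (a partition of $V_a$) such that $E(H)=\bigl(\bigcup_{i=1}^{a-1}\binom{V_{i}}{r}\bigr)\cup\bigl(\bigcup_{j=0}^{k}\binom{V_{a}\setminus U_{j}}{r}\bigr)$. Let $\eta_{r}(n,a,k)=\min\{e(H): H\in\mathcal{L}^{r}_{n,a,k}\}$ and $\eta_{r}(a,k)=\lim_{n\to\infty}\eta_{r}(n,a,k)/\binom{n}{r}$. -}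

module Defs where

open import Data.Nat using (ℕ; zero; suc; _∸_; _≡ᵇ_)
open import Data.Nat.Combinatorics using (_C_)
open import Data.Bool using (Bool; true; false; _∧_; _∨_; not)
open import Data.Fin using (Fin)
open import Data.Fin.Properties using () renaming (_≟_ to _≟F_)
open import Data.Fin.Subset using (Subset; ∣_∣)
open import Data.Vec using (lookup)
open import Data.List using (List; []; _∷_; _++_; map; filter; length; allFin; upTo)
open import Data.Bool.ListAction using (all; any)
open import Data.Sum using (_⊎_; inj₁; inj₂)
open import Data.Product using (Σ; _×_)
open import Data.Integer using (ℤ; +_)
open import Data.Rational using (ℚ; _/_; 0ℚ; 1ℚ; _*_; _+_; -_)
open import Relation.Nullary using (does)
open import Relation.Binary.PropositionalEquality using (_≡_)
import Data.Nat as ℕ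

subsets : (n : ℕ) → List (Subset n)
subsets zero = Data.Vec.[] ∷ []
subsets (suc n) = map (false Data.Vec.∷_) (subsets n) ++ map (true Data.Vec.∷_) (subsets n)

-- A vertex labelling describing the partition
--   V(H) = V₁ ∪ ... ∪ V_{a-1} ∪ V_a,  V_a = U₀ ∪ ... ∪ U_k,
-- where a = suc a'.  Vertex x lies in V_{i+1} iff  c x = inj₁ i  (i : Fin a'),
-- and in U_j ⊆ V_a iff  c x = inj₂ j  (j : Fin (suc k)).
Labelling : (n a' k : ℕ) → Set
Labelling n a' k = Fin n → Fin a' ⊎ Fin (suc k)

module _ {n a' k : ℕ} (c : Labelling n a' k) where

  allIn : (Fin a' ⊎ Fin (suc k) → Bool) → Subset n → Bool
  allIn p S = all (λ x → not (lookup S x) ∨ p (c x)) (allFin n)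

  isPart : Fin a' → Fin a' ⊎ Fin (suc k) → Bool
  isPart i (inj₁ i') = does (i ≟F i')
  isPart i (inj₂ _)  = false

  inVa : Fin a' ⊎ Fin (suc k) → Bool
  inVa (inj₁ _) = false
  inVa (inj₂ _) = true

  notU : Fin (suc k) → Fin a' ⊎ Fin (suc k) → Bool
  notU j (inj₁ _)  = false
  notU j (inj₂ j') = not (does (j ≟F j'))

  isEdge : ℕ → Subset n → Bool
  isEdge r S = (∣ S ∣ ≡ᵇ r) ∧
    (any (λ i → allIn (isPart i) S) (allFin a')
     ∨ any (λ j → allIn (notU j) S) (allFin (suc k)))

  edges : ℕ → ℕ
  edges r = length (filter (λ S → Data.Bool._≟_ (isEdge r S) true) (subsets n))

-- m = η_r(n,a,k) (with a = suc a'): m is the minimum of e(H) over H ∈ L^r_{n,a,k}.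
IsEta : (r n a' k m : ℕ) → Set
IsEta r n a' k m =
  Σ (Labelling n a' k) (λ c → edges c r ≡ m) × ((c : Labelling n a' k) → m ℕ.≤ edges c r)

-- m / d as a rational (0 when d = 0; only large n matter for the limit).
ratio : ℕ → ℕ → ℚ
ratio m zero    = 0ℚ
ratio m (suc d) = (+ m) / suc d

_^ℚ_ : ℚ → ℕ → ℚ
q ^ℚ zero  = 1ℚ
q ^ℚ suc e = q * (q ^ℚ e)

sgn : ℕ → ℚ
sgn zero          = 1ℚ
sgn (suc zero)    = - 1ℚ
sgn (suc (suc i)) = sgn i

term : ℕ → ℕ → ℕ → ℚ
term r k i = sgn (i ℕ.+ 1) * ((+ ((suc k) C (suc k ∸ i)) / 1) * ((+ (suc k ∸ i) / suc k) ^ℚ r))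

etaFormula : ℕ → ℕ → ℚ
etaFormula r k = Data.List.foldr (λ i acc → term r k (suc i) + acc) 0ℚ (upTo k)

-- With a = 1, an r-set is a non-edge exactly when it meets every class U₀, …, U_k, so
-- the non-edges are counted by the coefficient of z ^ r in ∏ⱼ ((1 + z) ^ |Uⱼ| − 1).
-- Moving a vertex from a larger class to a smaller one never decreases this coefficient,
-- so with K = k + 1 every partition has at most as many non-edges as K classes of size
-- ⌊n/K⌋ + 1, and a balanced partition at least as many as K classes of size ⌊n/K⌋.
-- For K classes of size q, expanding ((1 + z) ^ q − 1) ^ K gives
-- Σᵢ (−1) ^ i C(K, i) C((K − i) q, r), and C(j q, r) / C(n, r) → (j / K) ^ r when
-- q ≈ n / K.  So η_r(1, k) = 1 − Σ_{i=0}^{K} (−1) ^ i C(K, i) ((K − i) / K) ^ r, which is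
-- the stated sum once its i = 0 and i = K terms are accounted for.

module Submission where

module Convolution where

  open import Data.Nat using (ℕ; zero; suc; _+_; _*_; _≤_; z≤n)
  open import Data.Nat.Properties
  open import Algebra.Properties.CommutativeSemigroup +-commutativeSemigroup
    using (interchange; x∙yz≈y∙xz)
  open import Function using (_∘_)
  open import Relation.Binary.PropositionalEquality
  open ≡-Reasoning

  Seq : Set
  Seq = ℕ → ℕ

  infixl 6 _⊕_
  infixl 7 _⋆_ _·_
  infix  4 _≤ˢ_

  _⊕_ : Seq → Seq → Seq
  (a ⊕ b) t = a t + b t

  _·_ : ℕ → Seq → Seq
  (c · a) t = c * a t

  𝟘 : Seq
  𝟘 _ = 0

  δ : Seq
  δ zero    = 1
  δ (suc _) = 0

  shift : Seq → Seq
  shift a zero    = 0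
  shift a (suc t) = a t

  _⋆_ : Seq → Seq → Seq
  (a ⋆ b) zero    = a 0 * b 0
  (a ⋆ b) (suc t) = a 0 * b (suc t) + (a ∘ suc ⋆ b) t

  _≤ˢ_ : Seq → Seq → Set
  a ≤ˢ b = ∀ t → a t ≤ b t

  shift-cong : ∀ {a a′} → a ≗ a′ → shift a ≗ shift a′
  shift-cong p zero    = refl
  shift-cong p (suc t) = p t

  shift-mono-≤ : ∀ {a b} → a ≤ˢ b → shift a ≤ˢ shift b
  shift-mono-≤ p zero    = z≤n
  shift-mono-≤ p (suc t) = p t

  ⋆-cong : ∀ {a a′ b b′} → a ≗ a′ → b ≗ b′ → a ⋆ b ≗ a′ ⋆ b′
  ⋆-cong p q zero    = cong₂ _*_ (p 0) (q 0)
  ⋆-cong p q (suc t) = cong₂ _+_ (cong₂ _*_ (p 0) (q (suc t))) (⋆-cong (p ∘ suc) q t)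

  ⋆-unfoldˡ : ∀ a b → a ⋆ b ≗ a 0 · b ⊕ shift (a ∘ suc ⋆ b)
  ⋆-unfoldˡ a b zero    = sym (+-identityʳ _)
  ⋆-unfoldˡ a b (suc t) = refl

  ⋆-distribʳ-⊕ : ∀ a a′ b → (a ⊕ a′) ⋆ b ≗ a ⋆ b ⊕ a′ ⋆ b
  ⋆-distribʳ-⊕ a a′ b zero    = *-distribʳ-+ (b 0) (a 0) (a′ 0)
  ⋆-distribʳ-⊕ a a′ b (suc t) = begin
    (a 0 + a′ 0) * b (suc t) + ((a ⊕ a′) ∘ suc ⋆ b) t
      ≡⟨ cong₂ _+_ (*-distribʳ-+ (b (suc t)) (a 0) (a′ 0)) (⋆-distribʳ-⊕ (a ∘ suc) (a′ ∘ suc) b t) ⟩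
    (a 0 * b (suc t) + a′ 0 * b (suc t)) + ((a ∘ suc ⋆ b) t + (a′ ∘ suc ⋆ b) t)
      ≡⟨ interchange (a 0 * b (suc t)) _ ((a ∘ suc ⋆ b) t) _ ⟩
    (a ⋆ b ⊕ a′ ⋆ b) (suc t) ∎

  ⋆-distribˡ-⊕ : ∀ a b b′ → a ⋆ (b ⊕ b′) ≗ a ⋆ b ⊕ a ⋆ b′
  ⋆-distribˡ-⊕ a b b′ zero    = *-distribˡ-+ (a 0) (b 0) (b′ 0)
  ⋆-distribˡ-⊕ a b b′ (suc t) = begin
    a 0 * (b (suc t) + b′ (suc t)) + (a ∘ suc ⋆ (b ⊕ b′)) t
      ≡⟨ cong₂ _+_ (*-distribˡ-+ (a 0) (b (suc t)) (b′ (suc t))) (⋆-distribˡ-⊕ (a ∘ suc) b b′ t) ⟩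
    (a 0 * b (suc t) + a 0 * b′ (suc t)) + ((a ∘ suc ⋆ b) t + (a ∘ suc ⋆ b′) t)
      ≡⟨ interchange (a 0 * b (suc t)) _ ((a ∘ suc ⋆ b) t) _ ⟩
    (a ⋆ b ⊕ a ⋆ b′) (suc t) ∎

  ⋆-assoc-· : ∀ c a b → c · a ⋆ b ≗ c · (a ⋆ b)
  ⋆-assoc-· c a b zero    = *-assoc c (a 0) (b 0)
  ⋆-assoc-· c a b (suc t) = begin
    c * a 0 * b (suc t) + (c · a ∘ suc ⋆ b) t
      ≡⟨ cong₂ _+_ (*-assoc c (a 0) (b (suc t))) (⋆-assoc-· c (a ∘ suc) b t) ⟩
    c * (a 0 * b (suc t)) + c * (a ∘ suc ⋆ b) t
      ≡⟨ *-distribˡ-+ c _ _ ⟨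
    c * (a ⋆ b) (suc t) ∎

  ⋆-zeroˡ : ∀ b → 𝟘 ⋆ b ≗ 𝟘
  ⋆-zeroˡ b zero    = refl
  ⋆-zeroˡ b (suc t) = ⋆-zeroˡ b t

  ⋆-identityˡ : ∀ b → δ ⋆ b ≗ b
  ⋆-identityˡ b zero    = +-identityʳ (b 0)
  ⋆-identityˡ b (suc t) = trans (cong₂ _+_ (+-identityʳ (b (suc t))) (⋆-zeroˡ b t)) (+-identityʳ _)

  shift-⋆ : ∀ a b → shift a ⋆ b ≗ shift (a ⋆ b)
  shift-⋆ a b zero    = refl
  shift-⋆ a b (suc t) = refl

  ⋆-shift : ∀ a b → a ⋆ shift b ≗ shift (a ⋆ b)
  ⋆-shift a b zero          = *-zeroʳ (a 0)
  ⋆-shift a b (suc zero)    = trans (cong (a 0 * b 0 +_) (*-zeroʳ (a 1))) (+-identityʳ _)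
  ⋆-shift a b (suc (suc t)) = cong (a 0 * b (suc t) +_) (⋆-shift (a ∘ suc) b (suc t))

  ⋆-comm : ∀ a b → a ⋆ b ≗ b ⋆ a
  ⋆-comm a b zero       = *-comm (a 0) (b 0)
  ⋆-comm a b (suc zero) = trans (+-comm (a 0 * b 1) (a 1 * b 0))
    (cong₂ _+_ (*-comm (a 1) (b 0)) (*-comm (a 0) (b 1)))
  ⋆-comm a b (suc (suc t)) = begin
    a 0 * b (2 + t) + (a ∘ suc ⋆ b) (suc t)
      ≡⟨ cong (a 0 * b (2 + t) +_) (⋆-comm (a ∘ suc) b (suc t)) ⟩
    a 0 * b (2 + t) + (b 0 * a (2 + t) + (b ∘ suc ⋆ a ∘ suc) t)
      ≡⟨ cong (λ z → a 0 * b (2 + t) + (b 0 * a (2 + t) + z)) (⋆-comm (b ∘ suc) (a ∘ suc) t) ⟩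
    a 0 * b (2 + t) + (b 0 * a (2 + t) + (a ∘ suc ⋆ b ∘ suc) t)
      ≡⟨ x∙yz≈y∙xz (a 0 * b (2 + t)) (b 0 * a (2 + t)) _ ⟩
    b 0 * a (2 + t) + (a 0 * b (2 + t) + (a ∘ suc ⋆ b ∘ suc) t)
      ≡⟨ cong (b 0 * a (2 + t) +_) (⋆-comm (b ∘ suc) a (suc t)) ⟨
    (b ⋆ a) (suc (suc t)) ∎

  ⋆-identityʳ : ∀ a → a ⋆ δ ≗ a
  ⋆-identityʳ a t = trans (⋆-comm a δ t) (⋆-identityˡ a t)

  ⋆-assoc : ∀ a b c → (a ⋆ b) ⋆ c ≗ a ⋆ (b ⋆ c)
  ⋆-assoc a b c t = trans (peel t) (tail-assoc t)
    where
    peel : ∀ t → ((a ⋆ b) ⋆ c) t ≡ a 0 * (b ⋆ c) t + shift ((a ∘ suc ⋆ b) ⋆ c) t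
    peel t = begin
      ((a ⋆ b) ⋆ c) t                              ≡⟨ ⋆-cong (⋆-unfoldˡ a b) (λ _ → refl) t ⟩
      ((a 0 · b ⊕ shift (a ∘ suc ⋆ b)) ⋆ c) t      ≡⟨ ⋆-distribʳ-⊕ (a 0 · b) _ c t ⟩
      (a 0 · b ⋆ c) t + (shift (a ∘ suc ⋆ b) ⋆ c) t ≡⟨ cong₂ _+_ (⋆-assoc-· (a 0) b c t) (shift-⋆ _ c t) ⟩
      a 0 * (b ⋆ c) t + shift ((a ∘ suc ⋆ b) ⋆ c) t ∎
    tail-assoc : ∀ t → a 0 * (b ⋆ c) t + shift ((a ∘ suc ⋆ b) ⋆ c) t ≡ (a ⋆ (b ⋆ c)) t
    tail-assoc zero    = +-identityʳ _
    tail-assoc (suc t) = cong (a 0 * (b ⋆ c) (suc t) +_) (⋆-assoc (a ∘ suc) b c t)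

  ⋆-leftComm : ∀ a b c → a ⋆ (b ⋆ c) ≗ b ⋆ (a ⋆ c)
  ⋆-leftComm a b c t = begin
    (a ⋆ (b ⋆ c)) t ≡⟨ ⋆-assoc a b c t ⟨
    ((a ⋆ b) ⋆ c) t ≡⟨ ⋆-cong (⋆-comm a b) (λ _ → refl) t ⟩
    ((b ⋆ a) ⋆ c) t ≡⟨ ⋆-assoc b a c t ⟩
    (b ⋆ (a ⋆ c)) t ∎

  ⋆-monoˡ-≤ : ∀ {a a′} b → a ≤ˢ a′ → a ⋆ b ≤ˢ a′ ⋆ b
  ⋆-monoˡ-≤ b p zero    = *-monoˡ-≤ (b 0) (p 0)
  ⋆-monoˡ-≤ b p (suc t) = +-mono-≤ (*-monoˡ-≤ (b (suc t)) (p 0)) (⋆-monoˡ-≤ b (p ∘ suc) t)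

  ⋆-mono-≤ : ∀ {a a′ b b′} → a ≤ˢ a′ → b ≤ˢ b′ → a ⋆ b ≤ˢ a′ ⋆ b′
  ⋆-mono-≤ {a} {a′} {b} {b′} p q t = ≤-trans (⋆-monoˡ-≤ b p t)
    (subst₂ _≤_ (⋆-comm b a′ t) (⋆-comm b′ a′ t) (⋆-monoˡ-≤ a′ q t))

module Binomial where

  open import Data.Nat
  open import Data.Nat.Properties
  open import Data.Nat.Combinatorics using (_C_; nCk+nC[k+1]≡[n+1]C[k+1])
  open import Relation.Binary.PropositionalEquality
  open import Relation.Nullary using (yes; no)
  open Convolution

  -- Pascal's rule as the definition, so that the generating-function
  -- identities below hold by computation.
  choose : ℕ → Seq
  choose _       zero    = 1
  choose zero    (suc k) = 0
  choose (suc n) (suc k) = choose n k + choose n (suc k)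

  choose≡C : ∀ n k → choose n k ≡ n C k
  choose≡C n       zero    = refl
  choose≡C zero    (suc k) = refl
  choose≡C (suc n) (suc k) =
    trans (cong₂ _+_ (choose≡C n k) (choose≡C n (suc k))) (nCk+nC[k+1]≡[n+1]C[k+1] n k)

  choose-monoˡ-≤ : ∀ {m n} → m ≤ n → ∀ k → choose m k ≤ choose n k
  choose-monoˡ-≤ p               zero    = ≤-refl
  choose-monoˡ-≤ {zero}  p       (suc k) = z≤n
  choose-monoˡ-≤ {suc m} (s≤s p) (suc k) = +-mono-≤ (choose-monoˡ-≤ p k) (choose-monoˡ-≤ p (suc k))

  choose-1 : ∀ n → choose n 1 ≡ n
  choose-1 zero    = refl
  choose-1 (suc n) = cong suc (choose-1 n)

  n<k⇒choose≡0 : ∀ {n k} → n < k → choose n k ≡ 0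
  n<k⇒choose≡0 {zero}  {suc k} p       = refl
  n<k⇒choose≡0 {suc n} {suc k} (s≤s p) = cong₂ _+_ (n<k⇒choose≡0 p) (n<k⇒choose≡0 (m<n⇒m<1+n p))

  k≤n⇒0<choose : ∀ {n k} → k ≤ n → 1 ≤ choose n k
  k≤n⇒0<choose {n}     {zero}  p       = s≤s z≤n
  k≤n⇒0<choose {suc n} {suc k} (s≤s p) = ≤-trans (k≤n⇒0<choose p) (m≤m+n _ _)

  choose-suc-* : ∀ n k → choose n (suc k) * suc k ≡ choose n k * (n ∸ k)
  choose-suc-* zero    zero    = refl
  choose-suc-* zero    (suc k) = refl
  choose-suc-* (suc n) zero    = trans (*-identityʳ _) (cong suc (trans (choose-1 n) (sym (+-identityʳ n))))
  choose-suc-* (suc n) (suc k) = begin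
    (c + choose n (2 + k)) * (2 + k)      ≡⟨ *-distribʳ-+ (2 + k) c _ ⟩
    c * (2 + k) + choose n (2 + k) * (2 + k) ≡⟨ cong (c * (2 + k) +_) (choose-suc-* n (suc k)) ⟩
    c * (2 + k) + c * (n ∸ suc k)          ≡⟨ *-distribˡ-+ c _ _ ⟨
    c * (2 + k + (n ∸ suc k))              ≡⟨ vanishing-or-shift ⟩
    c * (suc k + (n ∸ k))                  ≡⟨ *-distribˡ-+ c _ _ ⟩
    c * suc k + c * (n ∸ k)                ≡⟨ cong (_+ c * (n ∸ k)) (choose-suc-* n k) ⟩
    choose n k * (n ∸ k) + c * (n ∸ k)     ≡⟨ *-distribʳ-+ (n ∸ k) (choose n k) c ⟨
    (choose n k + c) * (n ∸ k)             ∎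
    where
    open ≡-Reasoning
    c = choose n (suc k)
    vanishing-or-shift : c * (2 + k + (n ∸ suc k)) ≡ c * (suc k + (n ∸ k))
    vanishing-or-shift with suc k ≤? n
    ... | yes k<n = cong (λ z → c * suc z)
                      (sym (trans (cong (k +_) (+-∸-assoc 1 k<n)) (+-suc k (n ∸ suc k))))
    ... | no  k≮n = trans (cong (_* (2 + k + (n ∸ suc k))) c≡0) (sym (cong (_* (suc k + (n ∸ k))) c≡0))
      where c≡0 = n<k⇒choose≡0 (≰⇒> k≮n)

  -- The coefficients of (1 + z) ^ n − 1.
  choose⁺ : ℕ → Seq
  choose⁺ n zero    = 0
  choose⁺ n (suc s) = choose n (suc s)

  choose-zero : choose 0 ≗ δ
  choose-zero zero    = refl
  choose-zero (suc s) = refl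

  choose⁺-zero : choose⁺ 0 ≗ 𝟘
  choose⁺-zero zero    = refl
  choose⁺-zero (suc s) = refl

  choose-suc : ∀ n → choose (suc n) ≗ choose n ⊕ shift (choose n)
  choose-suc n zero    = refl
  choose-suc n (suc s) = +-comm (choose n s) (choose n (suc s))

  choose⁺-suc : ∀ n → choose⁺ (suc n) ≗ choose⁺ n ⊕ shift (choose n)
  choose⁺-suc n zero    = refl
  choose⁺-suc n (suc s) = +-comm (choose n s) (choose n (suc s))

  choose≗choose⁺⊕δ : ∀ n → choose n ≗ choose⁺ n ⊕ δ
  choose≗choose⁺⊕δ n zero    = refl
  choose≗choose⁺⊕δ n (suc s) = sym (+-identityʳ _)

  choose⁺-monoˡ-≤ : ∀ {m n} → m ≤ n → choose⁺ m ≤ˢ choose⁺ n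
  choose⁺-monoˡ-≤ p zero    = ≤-refl
  choose⁺-monoˡ-≤ p (suc s) = choose-monoˡ-≤ p (suc s)

  vandermonde : ∀ m n → choose m ⋆ choose n ≗ choose (m + n)
  vandermonde zero    n t = trans (⋆-cong choose-zero (λ _ → refl) t) (⋆-identityˡ (choose n) t)
  vandermonde (suc m) n t = begin
    (choose (suc m) ⋆ choose n) t
      ≡⟨ ⋆-cong (choose-suc m) (λ _ → refl) t ⟩
    ((choose m ⊕ shift (choose m)) ⋆ choose n) t
      ≡⟨ ⋆-distribʳ-⊕ (choose m) _ (choose n) t ⟩
    (choose m ⋆ choose n) t + (shift (choose m) ⋆ choose n) t
      ≡⟨ cong₂ _+_ (vandermonde m n t) (trans (shift-⋆ (choose m) (choose n) t)
                                              (shift-cong (vandermonde m n) t)) ⟩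
    (choose (m + n) ⊕ shift (choose (m + n))) t
      ≡⟨ choose-suc (m + n) t ⟨
    choose (suc m + n) t ∎
    where open ≡-Reasoning

module Transversals where

  open import Data.Nat
  open import Data.Nat.Properties
  open import Data.Nat.Solver using (module +-*-Solver)
  open import Data.List using (List; []; _∷_)
  open import Data.List.Relation.Binary.Pointwise using (Pointwise; []; _∷_)
  open import Data.List.Relation.Binary.Permutation.Propositional as ↭ using (_↭_)
  open import Relation.Binary.PropositionalEquality
  open Convolution
  open Binomial
  open +-*-Solver

  -- transversals xs t: the number of t-subsets of a set partitioned into
  -- parts of sizes xs that meet every part.
  transversals : List ℕ → Seq
  transversals []       = δ
  transversals (x ∷ xs) = choose⁺ x ⋆ transversals xs

  transversals-↭ : ∀ {xs ys} → xs ↭ ys → transversals xs ≗ transversals ys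
  transversals-↭ ↭.refl         t = refl
  transversals-↭ (↭.prep x p)   t = ⋆-cong (λ _ → refl) (transversals-↭ p) t
  transversals-↭ (↭.swap x y p) t = trans (⋆-leftComm (choose⁺ x) (choose⁺ y) _ t)
    (⋆-cong (λ _ → refl) (⋆-cong (λ _ → refl) (transversals-↭ p)) t)
  transversals-↭ (↭.trans p q)  t = trans (transversals-↭ p t) (transversals-↭ q t)

  transversals-mono-≤ : ∀ {xs ys} → Pointwise _≤_ xs ys → transversals xs ≤ˢ transversals ys
  transversals-mono-≤ []       t = ≤-refl
  transversals-mono-≤ (p ∷ ps) t = ⋆-mono-≤ (choose⁺-monoˡ-≤ p) (transversals-mono-≤ ps) t

  -- The s-subsets of an (m + n)-set, split as m | n, that miss one of the two sides.
  oneSided : ℕ → ℕ → Seq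
  oneSided m n = choose⁺ m ⊕ choose⁺ n ⊕ δ

  choose⁺⋆choose⁺⊕oneSided : ∀ m n → choose⁺ m ⋆ choose⁺ n ⊕ oneSided m n ≗ choose (m + n)
  choose⁺⋆choose⁺⊕oneSided m n t = begin
    (choose⁺ m ⋆ choose⁺ n) t + (choose⁺ m t + choose⁺ n t + δ t)
      ≡⟨ solve 4 (λ p a b d → p :+ (a :+ b :+ d) := p :+ a :+ (b :+ d)) refl
           ((choose⁺ m ⋆ choose⁺ n) t) (choose⁺ m t) (choose⁺ n t) (δ t) ⟩
    (choose⁺ m ⋆ choose⁺ n) t + choose⁺ m t + (choose⁺ n t + δ t)
      ≡⟨ cong₂ (λ x y → (choose⁺ m ⋆ choose⁺ n) t + x + y)
           (⋆-identityʳ (choose⁺ m) t) (⋆-identityˡ (choose⁺ n ⊕ δ) t) ⟨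
    (choose⁺ m ⋆ choose⁺ n) t + (choose⁺ m ⋆ δ) t + (δ ⋆ (choose⁺ n ⊕ δ)) t
      ≡⟨ cong (_+ (δ ⋆ (choose⁺ n ⊕ δ)) t) (⋆-distribˡ-⊕ (choose⁺ m) (choose⁺ n) δ t) ⟨
    (choose⁺ m ⋆ (choose⁺ n ⊕ δ)) t + (δ ⋆ (choose⁺ n ⊕ δ)) t
      ≡⟨ ⋆-distribʳ-⊕ (choose⁺ m) δ _ t ⟨
    ((choose⁺ m ⊕ δ) ⋆ (choose⁺ n ⊕ δ)) t
      ≡⟨ ⋆-cong (choose≗choose⁺⊕δ m) (choose≗choose⁺⊕δ n) t ⟨
    (choose m ⋆ choose n) t
      ≡⟨ vandermonde m n t ⟩
    choose (m + n) t ∎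
    where open ≡-Reasoning

  oneSided-sucˡ : ∀ m n → oneSided (suc m) n ≗ oneSided m n ⊕ shift (choose m)
  oneSided-sucˡ m n t = trans (cong (λ z → z + choose⁺ n t + δ t) (choose⁺-suc m t))
    (solve 4 (λ a s b d → a :+ s :+ b :+ d := a :+ b :+ d :+ s) refl
      (choose⁺ m t) (shift (choose m) t) (choose⁺ n t) (δ t))

  oneSided-sucʳ : ∀ m n → oneSided m (suc n) ≗ oneSided m n ⊕ shift (choose n)
  oneSided-sucʳ m n t = trans (cong (λ z → choose⁺ m t + z + δ t) (choose⁺-suc n t))
    (solve 4 (λ a b s d → a :+ (b :+ s) :+ d := a :+ b :+ d :+ s) refl
      (choose⁺ m t) (choose⁺ n t) (shift (choose n) t) (δ t))

  -- Both sides complete to choose (m + n + 1) and the complement on the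
  -- left is the larger one.
  choose⁺-exchange : ∀ {m n} → n ≤ m → choose⁺ (suc m) ⋆ choose⁺ n ≤ˢ choose⁺ m ⋆ choose⁺ (suc n)
  choose⁺-exchange {m} {n} n≤m t =
    +-cancelʳ-≤ (oneSided m (suc n) t) ((choose⁺ (suc m) ⋆ choose⁺ n) t) _ (begin
      (choose⁺ (suc m) ⋆ choose⁺ n) t + oneSided m (suc n) t
        ≤⟨ +-monoʳ-≤ ((choose⁺ (suc m) ⋆ choose⁺ n) t) complement-≤ ⟩
      (choose⁺ (suc m) ⋆ choose⁺ n) t + oneSided (suc m) n t
        ≡⟨ choose⁺⋆choose⁺⊕oneSided (suc m) n t ⟩
      choose (suc m + n) t
        ≡⟨ cong (λ z → choose z t) (+-suc m n) ⟨
      choose (m + suc n) t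
        ≡⟨ choose⁺⋆choose⁺⊕oneSided m (suc n) t ⟨
      (choose⁺ m ⋆ choose⁺ (suc n)) t + oneSided m (suc n) t ∎)
    where
    open ≤-Reasoning
    complement-≤ : oneSided m (suc n) t ≤ oneSided (suc m) n t
    complement-≤ = begin
      oneSided m (suc n) t                     ≡⟨ oneSided-sucʳ m n t ⟩
      oneSided m n t + shift (choose n) t      ≤⟨ +-monoʳ-≤ (oneSided m n t)
                                                   (shift-mono-≤ (choose-monoˡ-≤ n≤m) t) ⟩
      oneSided m n t + shift (choose m) t      ≡⟨ oneSided-sucˡ m n t ⟨
      oneSided (suc m) n t                     ∎

  transversals-exchange : ∀ {m n} xs → n ≤ m →
    transversals (suc m ∷ n ∷ xs) ≤ˢ transversals (m ∷ suc n ∷ xs)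
  transversals-exchange {m} {n} xs n≤m t = begin
    (choose⁺ (suc m) ⋆ (choose⁺ n ⋆ transversals xs)) t
      ≡⟨ ⋆-assoc (choose⁺ (suc m)) (choose⁺ n) (transversals xs) t ⟨
    (choose⁺ (suc m) ⋆ choose⁺ n ⋆ transversals xs) t
      ≤⟨ ⋆-monoˡ-≤ (transversals xs) (choose⁺-exchange n≤m) t ⟩
    (choose⁺ m ⋆ choose⁺ (suc n) ⋆ transversals xs) t
      ≡⟨ ⋆-assoc (choose⁺ m) (choose⁺ (suc n)) (transversals xs) t ⟩
    (choose⁺ m ⋆ (choose⁺ (suc n) ⋆ transversals xs)) t ∎
    where open ≤-Reasoning

module Smoothing where

  open import Data.Nat
  open import Data.Nat.Properties
  open import Data.Nat.DivMod using (_/_; _%_; m≡m%n+[m/n]*n; m%n<n)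
  open import Data.Nat.ListAction using (sum)
  open import Data.Nat.ListAction.Properties using (sum-↭)
  open import Data.List using (List; []; _∷_; length; map; replicate)
  open import Data.List.Relation.Unary.All as All using (All; []; _∷_)
  open import Data.List.Relation.Unary.All.Properties using (¬Any⇒All¬)
  open import Data.List.Relation.Unary.Any using (Any; here; there; any?)
  open import Data.List.Relation.Binary.Pointwise using (Pointwise; []; _∷_)
  open import Data.List.Relation.Binary.Permutation.Propositional as ↭ using (_↭_)
  open import Data.List.Relation.Binary.Permutation.Propositional.Properties using (↭-length; map⁺)
  open import Data.Product using (∃₂; _×_; _,_)
  open import Data.Empty using (⊥-elim)
  open import Relation.Nullary using (yes; no)
  open import Relation.Unary using (Pred)
  open import Relation.Binary.PropositionalEquality
  open Convolution
  open Transversals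

  Any⇒↭∷ : ∀ {a p} {A : Set a} {P : Pred A p} {xs} → Any P xs → ∃₂ λ x ys → P x × xs ↭ x ∷ ys
  Any⇒↭∷ (here px)  = _ , _ , px , ↭.refl
  Any⇒↭∷ (there pxs) with Any⇒↭∷ pxs
  ... | x , ys , px , σ = x , _ ∷ ys , px , ↭.trans (↭.prep _ σ) (↭.swap _ _ ↭.refl)

  length*≤sum : ∀ {b} xs → All (b ≤_) xs → length xs * b ≤ sum xs
  length*≤sum []       []       = z≤n
  length*≤sum (x ∷ xs) (p ∷ ps) = +-mono-≤ p (length*≤sum xs ps)

  All≤⇒≤replicate : ∀ {b} xs → All (_≤ b) xs → Pointwise _≤_ xs (replicate (length xs) b)
  All≤⇒≤replicate []       []       = []
  All≤⇒≤replicate (x ∷ xs) (p ∷ ps) = p ∷ All≤⇒≤replicate xs ps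

  excess : ℕ → List ℕ → ℕ
  excess b xs = sum (map (_∸ b) xs)

  excess-exchange : ∀ {b x y} zs → b ≤ x → y < b →
    excess b (suc x ∷ y ∷ zs) ≡ suc (excess b (x ∷ suc y ∷ zs))
  excess-exchange {b} {x} {y} zs b≤x y<b = begin
    (suc x ∸ b) + ((y ∸ b) + excess b zs)     ≡⟨ cong₂ (λ u v → u + (v + excess b zs))
                                                   (+-∸-assoc 1 b≤x) (m≤n⇒m∸n≡0 (<⇒≤ y<b)) ⟩
    suc (x ∸ b) + excess b zs                 ≡⟨ cong (λ v → suc ((x ∸ b) + (v + excess b zs)))
                                                   (m≤n⇒m∸n≡0 y<b) ⟨
    suc ((x ∸ b) + ((suc y ∸ b) + excess b zs)) ∎
    where open ≡-Reasoning

  -- The fuel d bounds the excess, which each exchange lowers by one.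
  smoothing : ∀ b d xs → excess b xs < d → sum xs < length xs * b →
    transversals xs ≤ˢ transversals (replicate (length xs) b)
  smoothing b (suc d) xs (s≤s excess≤d) sum< with any? (b <?_) xs
  ... | no ¬large = transversals-mono-≤ (All≤⇒≤replicate xs (All.map ≮⇒≥ (¬Any⇒All¬ xs ¬large)))
  ... | yes large with Any⇒↭∷ large
  ...   | zero  , ys , ()  , σ
  ...   | suc x , ys , b<1+x , σ with any? (_<? b) ys
  ...     | no ¬small = ⊥-elim (<⇒≱ sum< (begin
            length xs * b            ≡⟨ cong (_* b) (↭-length σ) ⟩
            b + length ys * b        ≤⟨ +-mono-≤ (<⇒≤ b<1+x)
                                          (length*≤sum ys (All.map ≮⇒≥ (¬Any⇒All¬ ys ¬small))) ⟩
            suc x + sum ys           ≡⟨ sum-↭ σ ⟨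
            sum xs                   ∎))
    where open ≤-Reasoning
  ...     | yes small with Any⇒↭∷ small
  ...       | y , zs , y<b , τ = λ t → begin
            transversals xs t                            ≡⟨ transversals-↭ ρ t ⟩
            transversals (suc x ∷ y ∷ zs) t              ≤⟨ transversals-exchange zs y≤x t ⟩
            transversals xs′ t                           ≤⟨ smoothing b d xs′ excess< sum′< t ⟩
            transversals (replicate (length xs′) b) t    ≡⟨ cong (λ l → transversals (replicate l b) t)
                                                              (↭-length ρ) ⟨
            transversals (replicate (length xs) b) t     ∎
    where
    open ≤-Reasoning
    ρ : xs ↭ suc x ∷ y ∷ zs
    ρ = ↭.trans σ (↭.prep (suc x) τ)
    xs′ = x ∷ suc y ∷ zs
    b≤x : b ≤ x
    b≤x = s≤s⁻¹ b<1+x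
    y≤x : y ≤ x
    y≤x = ≤-trans (<⇒≤ y<b) b≤x
    excess< : excess b xs′ < d
    excess< = ≤-trans (≤-reflexive (sym (trans (sum-↭ (map⁺ (_∸ b) ρ)) (excess-exchange zs b≤x y<b))))
                excess≤d
    sum′< : sum xs′ < length xs′ * b
    sum′< = subst₂ (λ s l → s < l * b) (trans (sum-↭ ρ) (sym (+-suc x (y + sum zs)))) (↭-length ρ) sum<

  <[1+m/n]*n : ∀ m n .{{_ : NonZero n}} → m < suc (m / n) * n
  <[1+m/n]*n m n = begin-strict
    m                     ≡⟨ m≡m%n+[m/n]*n m n ⟩
    m % n + (m / n) * n   <⟨ +-monoˡ-< ((m / n) * n) (m%n<n m n) ⟩
    n + (m / n) * n       ∎
    where open ≤-Reasoning

  transversals-≤-balanced : ∀ K .{{_ : NonZero K}} xs → length xs ≡ K →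
    transversals xs ≤ˢ transversals (replicate K (suc (sum xs / K)))
  transversals-≤-balanced K xs refl =
    smoothing (suc (sum xs / K)) (suc (excess (suc (sum xs / K)) xs)) xs ≤-refl
      (subst (sum xs <_) (*-comm (suc (sum xs / K)) K) (<[1+m/n]*n (sum xs) K))

module Counting where

  open import Data.Nat using (ℕ; suc; _+_)
  open import Data.Nat.Properties using (+-suc)
  open import Data.Bool using (Bool; true; false; _∧_; not; if_then_else_; _≟_)
  open import Data.List using (List; []; _∷_; _++_; map; filter; length)
  open import Function using (_∘_)
  open import Relation.Binary.PropositionalEquality

  countᵇ : ∀ {a} {A : Set a} → (A → Bool) → List A → ℕ
  countᵇ p []       = 0
  countᵇ p (x ∷ xs) = if p x then suc (countᵇ p xs) else countᵇ p xs

  module _ {a} {A : Set a} where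

    length-filter≡countᵇ : ∀ (p : A → Bool) xs → length (filter (λ x → p x ≟ true) xs) ≡ countᵇ p xs
    length-filter≡countᵇ p []       = refl
    length-filter≡countᵇ p (x ∷ xs) with p x
    ... | true  = cong suc (length-filter≡countᵇ p xs)
    ... | false = length-filter≡countᵇ p xs

    countᵇ-cong : ∀ {p q : A → Bool} → (∀ x → p x ≡ q x) → ∀ xs → countᵇ p xs ≡ countᵇ q xs
    countᵇ-cong e []       = refl
    countᵇ-cong {p} {q} e (x ∷ xs) rewrite e x with q x
    ... | true  = cong suc (countᵇ-cong e xs)
    ... | false = countᵇ-cong e xs

    countᵇ-++ : ∀ (p : A → Bool) xs ys → countᵇ p (xs ++ ys) ≡ countᵇ p xs + countᵇ p ys
    countᵇ-++ p []       ys = refl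
    countᵇ-++ p (x ∷ xs) ys with p x
    ... | true  = cong suc (countᵇ-++ p xs ys)
    ... | false = countᵇ-++ p xs ys

    countᵇ-false : ∀ (xs : List A) → countᵇ (λ _ → false) xs ≡ 0
    countᵇ-false []       = refl
    countᵇ-false (x ∷ xs) = countᵇ-false xs

    countᵇ-∧-split : ∀ (p q : A → Bool) xs →
      countᵇ (λ x → p x ∧ q x) xs + countᵇ (λ x → p x ∧ not (q x)) xs ≡ countᵇ p xs
    countᵇ-∧-split p q []       = refl
    countᵇ-∧-split p q (x ∷ xs) with p x | q x
    ... | true  | true  = cong suc (countᵇ-∧-split p q xs)
    ... | true  | false = trans (+-suc _ _) (cong suc (countᵇ-∧-split p q xs))
    ... | false | _     = countᵇ-∧-split p q xs

  countᵇ-map : ∀ {a b} {A : Set a} {B : Set b} (p : B → Bool) (f : A → B) xs →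
    countᵇ p (map f xs) ≡ countᵇ (p ∘ f) xs
  countᵇ-map p f []       = refl
  countᵇ-map p f (x ∷ xs) with p (f x)
  ... | true  = cong suc (countᵇ-map p f xs)
  ... | false = countᵇ-map p f xs

module Hitting where

  open import Data.Nat using (ℕ; zero; suc; _+_; _≡ᵇ_)
  open import Data.Nat.Properties using (+-identityʳ; +-comm; +-suc)
  open import Data.Nat.ListAction using (sum)
  open import Data.Bool using (Bool; true; false; _∧_; _∨_; not; if_then_else_)
  open import Data.Bool.Properties using (∧-assoc; ∧-zeroʳ; ∧-identityʳ)
  open import Data.Fin using (Fin; zero; suc)
  open import Data.Fin.Properties using () renaming (_≟_ to _≟ᶠ_)
  open import Data.Fin.Subset using (Subset; ∣_∣)
  open import Data.Vec using (_∷_; []; lookup)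
  open import Data.Vec.Functional using (updateAt) renaming (foldr to foldrᶠ)
  open import Data.List using ([]; _∷_; _++_; map; tabulate)
  open import Data.Bool.ListAction using (all; any)
  open import Function using (_∘_)
  open import Relation.Nullary using (does)
  open import Relation.Binary.PropositionalEquality
  open import Defs using (subsets)
  open Convolution
  open Binomial
  open Counting
  open Transversals

  allᶠ anyᶠ : ∀ {m} → (Fin m → Bool) → Bool
  allᶠ = foldrᶠ _∧_ true
  anyᶠ = foldrᶠ _∨_ false

  anyᶠ-cong : ∀ {m} {f g : Fin m → Bool} → f ≗ g → anyᶠ f ≡ anyᶠ g
  anyᶠ-cong {zero}  e = refl
  anyᶠ-cong {suc m} e = cong₂ _∨_ (e zero) (anyᶠ-cong (e ∘ suc))

  allᶠ-cong : ∀ {m} {f g : Fin m → Bool} → f ≗ g → allᶠ f ≡ allᶠ g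
  allᶠ-cong {zero}  e = refl
  allᶠ-cong {suc m} e = cong₂ _∧_ (e zero) (allᶠ-cong (e ∘ suc))

  all-tabulate : ∀ {a} {A : Set a} {m} (f : A → Bool) (g : Fin m → A) → all f (tabulate g) ≡ allᶠ (f ∘ g)
  all-tabulate {m = zero}  f g = refl
  all-tabulate {m = suc m} f g = cong (f (g zero) ∧_) (all-tabulate f (g ∘ suc))

  any-tabulate : ∀ {a} {A : Set a} {m} (f : A → Bool) (g : Fin m → A) → any f (tabulate g) ≡ anyᶠ (f ∘ g)
  any-tabulate {m = zero}  f g = refl
  any-tabulate {m = suc m} f g = cong (f (g zero) ∨_) (any-tabulate f (g ∘ suc))

  countᵇ-size : ∀ n t → countᵇ (λ S → ∣ S ∣ ≡ᵇ t) (subsets n) ≡ choose n t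
  countᵇ-size zero    zero    = refl
  countᵇ-size zero    (suc t) = refl
  countᵇ-size (suc n) t = begin
    countᵇ p (map (false ∷_) (subsets n) ++ map (true ∷_) (subsets n))
      ≡⟨ countᵇ-++ p (map (false ∷_) (subsets n)) _ ⟩
    countᵇ p (map (false ∷_) (subsets n)) + countᵇ p (map (true ∷_) (subsets n))
      ≡⟨ cong₂ _+_ (countᵇ-map p (false ∷_) (subsets n)) (countᵇ-map p (true ∷_) (subsets n)) ⟩
    countᵇ (λ S → ∣ S ∣ ≡ᵇ t) (subsets n) + countᵇ (λ S → suc ∣ S ∣ ≡ᵇ t) (subsets n)
      ≡⟨ by-size t ⟩
    choose (suc n) t ∎
    where
    open ≡-Reasoning
    p = λ (S : Subset (suc n)) → ∣ S ∣ ≡ᵇ t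
    by-size : ∀ t → countᵇ (λ S → ∣ S ∣ ≡ᵇ t) (subsets n) + countᵇ (λ S → suc ∣ S ∣ ≡ᵇ t) (subsets n)
                    ≡ choose (suc n) t
    by-size zero    = trans (cong (countᵇ (λ S → ∣ S ∣ ≡ᵇ zero) (subsets n) +_) (countᵇ-false (subsets n)))
                        (trans (+-identityʳ _) (countᵇ-size n zero))
    by-size (suc t) = trans (cong₂ _+_ (countᵇ-size n (suc t)) (countᵇ-size n t))
                        (+-comm (choose n (suc t)) (choose n t))

  module _ {n K : ℕ} where

    avoids : (Fin n → Fin K) → Fin K → Subset n → Bool
    avoids col j S = allᶠ (λ x → not (lookup S x) ∨ not (does (j ≟ᶠ col x)))

    misses : (Fin n → Fin K) → (Fin K → Bool) → Subset n → Bool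
    misses col req S = anyᶠ (λ j → req j ∧ avoids col j S)

    hitting : (Fin n → Fin K) → (Fin K → Bool) → Seq
    hitting col req t = countᵇ (λ S → (∣ S ∣ ≡ᵇ t) ∧ not (misses col req S)) (subsets n)

  sizes : ∀ {n K} → (Fin n → Fin K) → Fin K → ℕ
  sizes {zero}  col = λ _ → 0
  sizes {suc n} col = updateAt (sizes (col ∘ suc)) (col zero) suc

  factor : ℕ → Bool → Seq
  factor x true  = choose⁺ x
  factor x false = choose x

  hittingSeq : ∀ {K} → (Fin K → ℕ) → (Fin K → Bool) → Seq
  hittingSeq {zero}  x req = δ
  hittingSeq {suc K} x req = factor (x zero) (req zero) ⋆ hittingSeq (x ∘ suc) (req ∘ suc)

  hittingSeq-true : ∀ {K} (x : Fin K → ℕ) → hittingSeq x (λ _ → true) ≗ transversals (tabulate x)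
  hittingSeq-true {zero}  x t = refl
  hittingSeq-true {suc K} x t = ⋆-cong (λ _ → refl) (hittingSeq-true (x ∘ suc)) t

  hittingSeq-zero : ∀ {K} (req : Fin K → Bool) t →
    hittingSeq (λ _ → 0) req t ≡ (if (0 ≡ᵇ t) ∧ not (anyᶠ req) then 1 else 0)
  hittingSeq-zero {zero}  req zero    = refl
  hittingSeq-zero {zero}  req (suc t) = refl
  hittingSeq-zero {suc K} req t with req zero
  ... | true  = trans (⋆-cong choose⁺-zero (λ _ → refl) t)
                  (trans (⋆-zeroˡ _ t) (cong (λ b → if b then 1 else 0) (sym (∧-zeroʳ (0 ≡ᵇ t)))))
  ... | false = trans (⋆-cong choose-zero (λ _ → refl) t)
                  (trans (⋆-identityˡ _ t) (hittingSeq-zero (req ∘ suc) t))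

  factor-suc : ∀ x b → factor (suc x) b ≗ factor x b ⊕ shift (choose x)
  factor-suc x true  = choose⁺-suc x
  factor-suc x false = choose-suc x

  -- A new vertex of colour j either lies outside the subset, or inside it,
  -- in which case colour j no longer needs to be met.
  hittingSeq-updateAt : ∀ {K} (j : Fin K) x req →
    hittingSeq (updateAt x j suc) req ≗
      hittingSeq x req ⊕ shift (hittingSeq x (updateAt req j (λ _ → false)))
  hittingSeq-updateAt zero x req t =
    trans (⋆-cong (factor-suc (x zero) (req zero)) (λ _ → refl) t)
      (trans (⋆-distribʳ-⊕ (factor (x zero) (req zero)) _ rest t)
        (cong ((factor (x zero) (req zero) ⋆ rest) t +_) (shift-⋆ (choose (x zero)) rest t)))
    where rest = hittingSeq (x ∘ suc) (req ∘ suc)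
  hittingSeq-updateAt (suc j) x req t =
    trans (⋆-cong (λ _ → refl) (hittingSeq-updateAt j (x ∘ suc) (req ∘ suc)) t)
      (trans (⋆-distribˡ-⊕ first (hittingSeq (x ∘ suc) (req ∘ suc)) _ t)
        (cong ((first ⋆ hittingSeq (x ∘ suc) (req ∘ suc)) t +_) (⋆-shift first _ t)))
    where first = factor (x zero) (req zero)

  updateAt-false : ∀ {K} (j : Fin K) (req : Fin K → Bool) i →
    updateAt req j (λ _ → false) i ≡ req i ∧ not (does (i ≟ᶠ j))
  updateAt-false zero    req zero    = sym (∧-zeroʳ (req zero))
  updateAt-false zero    req (suc i) = sym (∧-identityʳ (req (suc i)))
  updateAt-false (suc j) req zero    = sym (∧-identityʳ (req zero))
  updateAt-false (suc j) req (suc i) = updateAt-false j (req ∘ suc) i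

  misses-true : ∀ {n K} (col : Fin (suc n) → Fin K) req S →
    misses col req (true ∷ S) ≡ misses (col ∘ suc) (updateAt req (col zero) (λ _ → false)) S
  misses-true col req S = anyᶠ-cong λ j → trans
    (sym (∧-assoc (req j) (not (does (j ≟ᶠ col zero))) (avoids (col ∘ suc) j S)))
    (cong (_∧ avoids (col ∘ suc) j S) (sym (updateAt-false (col zero) req j)))

  hitting≗hittingSeq : ∀ {n K} (col : Fin n → Fin K) req → hitting col req ≗ hittingSeq (sizes col) req
  hitting≗hittingSeq {zero} col req t =
    trans (cong (λ b → if (0 ≡ᵇ t) ∧ not b then 1 else 0) (anyᶠ-cong (λ j → ∧-identityʳ (req j))))
      (sym (hittingSeq-zero req t))
  hitting≗hittingSeq {suc n} col req t = begin
    countᵇ p (map (false ∷_) (subsets n) ++ map (true ∷_) (subsets n))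
      ≡⟨ countᵇ-++ p (map (false ∷_) (subsets n)) _ ⟩
    countᵇ p (map (false ∷_) (subsets n)) + countᵇ p (map (true ∷_) (subsets n))
      ≡⟨ cong₂ _+_ (countᵇ-map p (false ∷_) (subsets n)) (countᵇ-map p (true ∷_) (subsets n)) ⟩
    countᵇ (p ∘ (false ∷_)) (subsets n) + countᵇ (p ∘ (true ∷_)) (subsets n)
      ≡⟨ cong₂ _+_ (hitting≗hittingSeq (col ∘ suc) req t) (withVertex t) ⟩
    hittingSeq (sizes (col ∘ suc)) req t + shift (hittingSeq (sizes (col ∘ suc)) req′) t
      ≡⟨ hittingSeq-updateAt (col zero) (sizes (col ∘ suc)) req t ⟨
    hittingSeq (sizes col) req t ∎
    where
    open ≡-Reasoning
    p = λ S → (∣ S ∣ ≡ᵇ t) ∧ not (misses col req S)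
    req′ = updateAt req (col zero) (λ _ → false)
    withVertex : ∀ t → countᵇ (λ S → (suc ∣ S ∣ ≡ᵇ t) ∧ not (misses col req (true ∷ S))) (subsets n)
                       ≡ shift (hittingSeq (sizes (col ∘ suc)) req′) t
    withVertex zero    = countᵇ-false (subsets n)
    withVertex (suc t) =
      trans (countᵇ-cong (λ S → cong (λ b → (∣ S ∣ ≡ᵇ t) ∧ not b) (misses-true col req S)) (subsets n))
        (hitting≗hittingSeq (col ∘ suc) req′ t)

  sum-updateAt-suc : ∀ {K} (j : Fin K) x → sum (tabulate (updateAt x j suc)) ≡ suc (sum (tabulate x))
  sum-updateAt-suc zero    x = refl
  sum-updateAt-suc (suc j) x = trans (cong (x zero +_) (sum-updateAt-suc j (x ∘ suc))) (+-suc (x zero) _)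

  sum-zeros : ∀ K → sum (tabulate {n = K} (λ _ → 0)) ≡ 0
  sum-zeros zero    = refl
  sum-zeros (suc K) = sum-zeros K

  sum-sizes : ∀ {n K} (col : Fin n → Fin K) → sum (tabulate (sizes col)) ≡ n
  sum-sizes {zero}  {K} col = sum-zeros K
  sum-sizes {suc n}     col = trans (sum-updateAt-suc (col zero) (sizes (col ∘ suc))) (cong suc (sum-sizes (col ∘ suc)))

module EdgeCount where

  open import Data.Nat using (ℕ; zero; suc; _+_; _≡ᵇ_)
  open import Data.Bool using (true; _∧_; _∨_; not)
  open import Data.Fin using (Fin)
  open import Data.Fin.Properties using () renaming (_≟_ to _≟ᶠ_)
  open import Data.Fin.Subset using (Subset; ∣_∣)
  open import Data.Vec using (lookup)
  open import Data.List using (tabulate)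
  open import Data.Sum using (_⊎_; inj₂)
  open import Function using (_∘_; id)
  open import Relation.Nullary using (does)
  open import Relation.Binary.PropositionalEquality
  open import Defs
  open Binomial
  open Counting
  open Transversals
  open Hitting

  -- With a = 1 there are no parts V₁, …, V_{a-1}: a labelling is a colouring by Fin (suc k).
  colour : ∀ {k} → Fin 0 ⊎ Fin (suc k) → Fin (suc k)
  colour (inj₂ j) = j

  module _ {n k : ℕ} where

    notU≡ : (c : Labelling n 0 k) (j : Fin (suc k)) (y : Fin 0 ⊎ Fin (suc k)) →
      notU c j y ≡ not (does (j ≟ᶠ colour y))
    notU≡ c j (inj₂ _) = refl

    allIn-notU : (c : Labelling n 0 k) (j : Fin (suc k)) (S : Subset n) →
      allIn c (notU c j) S ≡ avoids (colour ∘ c) j S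
    allIn-notU c j S = trans (all-tabulate (λ x → not (lookup S x) ∨ notU c j (c x)) id)
      (allᶠ-cong (λ x → cong (not (lookup S x) ∨_) (notU≡ c j (c x))))

    isEdge≡ : (c : Labelling n 0 k) (r : ℕ) (S : Subset n) →
      isEdge c r S ≡ (∣ S ∣ ≡ᵇ r) ∧ misses (colour ∘ c) (λ _ → true) S
    isEdge≡ c r S = cong ((∣ S ∣ ≡ᵇ r) ∧_) (trans (any-tabulate (λ j → allIn c (notU c j) S) id)
      (anyᶠ-cong (λ j → allIn-notU c j S)))

    edges+transversals : (c : Labelling n 0 k) (r : ℕ) →
      edges c r + transversals (tabulate (sizes (colour ∘ c))) r ≡ choose n r
    edges+transversals c r = begin
      edges c r + transversals (tabulate (sizes (colour ∘ c))) r
        ≡⟨ cong₂ _+_ (trans (length-filter≡countᵇ (isEdge c r) (subsets n))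
                            (countᵇ-cong (isEdge≡ c r) (subsets n)))
                     (sym (trans (hitting≗hittingSeq (colour ∘ c) (λ _ → true) r)
                                 (hittingSeq-true (sizes (colour ∘ c)) r))) ⟩
      countᵇ (λ S → sized S ∧ missing S) (subsets n) + countᵇ (λ S → sized S ∧ not (missing S)) (subsets n)
        ≡⟨ countᵇ-∧-split sized missing (subsets n) ⟩
      countᵇ sized (subsets n)
        ≡⟨ countᵇ-size n r ⟩
      choose n r ∎
      where
      open ≡-Reasoning
      sized = λ (S : Subset n) → ∣ S ∣ ≡ᵇ r
      missing = misses (colour ∘ c) (λ _ → true)

module BalancedColouring where

  open import Data.Nat
  open import Data.Nat.Properties
  open import Data.Nat.DivMod using (_/_; _%_; m≡m%n+[m/n]*n)
  open import Data.Nat.ListAction using (sum)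
  open import Data.Nat.Solver using (module +-*-Solver)
  open import Data.Fin using (Fin; zero; suc)
  open import Data.Vec.Functional using (updateAt)
  open import Data.List using (tabulate; replicate)
  open import Data.List.Relation.Binary.Pointwise using (Pointwise; []; _∷_)
  open import Data.Product using (∃; ∃₂; _×_; _,_)
  open import Function using (_∘_)
  open import Relation.Binary.PropositionalEquality
  open Hitting using (sizes)
  open +-*-Solver

  updateAt-cong : ∀ {K} (j : Fin K) {x y : Fin K → ℕ} → x ≗ y → updateAt x j suc ≗ updateAt y j suc
  updateAt-cong zero    e zero    = cong suc (e zero)
  updateAt-cong zero    e (suc i) = e (suc i)
  updateAt-cong (suc j) e zero    = e zero
  updateAt-cong (suc j) e (suc i) = updateAt-cong j (e ∘ suc) i

  sum≡0 : ∀ {K} (x : Fin K → ℕ) → sum (tabulate x) ≡ 0 → ∀ j → x j ≡ 0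
  sum≡0 x e zero    = m+n≡0⇒m≡0 (x zero) e
  sum≡0 x e (suc j) = sum≡0 (x ∘ suc) (m+n≡0⇒n≡0 (x zero) e) j

  decrement : ∀ {K} n (x : Fin K → ℕ) → sum (tabulate x) ≡ suc n →
    ∃₂ λ j x′ → updateAt x′ j suc ≗ x × sum (tabulate x′) ≡ n
  decrement {zero}  n x ()
  decrement {suc K} n x e with x zero in x₀≡
  ... | suc a = zero , x′ , restore , suc-injective e
    where
    x′ : Fin (suc K) → ℕ
    x′ zero    = a
    x′ (suc i) = x (suc i)
    restore : updateAt x′ zero suc ≗ x
    restore zero    = sym x₀≡
    restore (suc i) = refl
  ... | zero with decrement n (x ∘ suc) e
  ...   | j , y , restore-tail , e′ = suc j , x′ , restore , e′
    where
    x′ : Fin (suc K) → ℕ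
    x′ zero    = 0
    x′ (suc i) = y i
    restore : updateAt x′ (suc j) suc ≗ x
    restore zero    = sym x₀≡
    restore (suc i) = restore-tail i

  colouring-with-sizes : ∀ {K} n (x : Fin K → ℕ) → sum (tabulate x) ≡ n →
    ∃ λ (col : Fin n → Fin K) → sizes col ≗ x
  colouring-with-sizes zero    x e = (λ ()) , λ j → sym (sum≡0 x e j)
  colouring-with-sizes {K} (suc n) x e with decrement n x e
  ... | j , x′ , restore , e′ with colouring-with-sizes n x′ e′
  ...   | col , sizes≗ = col′ , λ i → trans (updateAt-cong j sizes≗ i) (restore i)
    where
    col′ : Fin (suc n) → Fin K
    col′ zero    = j
    col′ (suc v) = col v

  sum-constant : ∀ m q → sum (tabulate {n = m} (λ _ → q)) ≡ m * q
  sum-constant zero    q = refl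
  sum-constant (suc m) q = cong (q +_) (sum-constant m q)

  replicate≤tabulate : ∀ {m} q (x : Fin m → ℕ) → (∀ j → q ≤ x j) → Pointwise _≤_ (replicate m q) (tabulate x)
  replicate≤tabulate {zero}  q x p = []
  replicate≤tabulate {suc m} q x p = p zero ∷ replicate≤tabulate q (x ∘ suc) (p ∘ suc)

  balancedSizes : ∀ k n → Fin (suc k) → ℕ
  balancedSizes k n zero    = n / suc k + n % suc k
  balancedSizes k n (suc _) = n / suc k

  sum-balancedSizes : ∀ k n → sum (tabulate (balancedSizes k n)) ≡ n
  sum-balancedSizes k n = begin
    q + n % suc k + sum (tabulate {n = k} (λ _ → q)) ≡⟨ cong (q + n % suc k +_) (sum-constant k q) ⟩
    q + n % suc k + k * q                          ≡⟨ solve 3 (λ q r k → q :+ r :+ k :* q := r :+ q :* (con 1 :+ k))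
                                                        refl q (n % suc k) k ⟩
    n % suc k + q * suc k                          ≡⟨ m≡m%n+[m/n]*n n (suc k) ⟨
    n                                              ∎
    where
    open ≡-Reasoning
    q = n / suc k

  ⌊n/K⌋≤balancedSizes : ∀ k n j → n / suc k ≤ balancedSizes k n j
  ⌊n/K⌋≤balancedSizes k n zero    = m≤m+n _ _
  ⌊n/K⌋≤balancedSizes k n (suc _) = ≤-refl

  balanced : ∀ k n → ∃ λ (col : Fin n → Fin (suc k)) →
    Pointwise _≤_ (replicate (suc k) (n / suc k)) (tabulate (sizes col))
  balanced k n with colouring-with-sizes n (balancedSizes k n) (sum-balancedSizes k n)
  ... | col , sizes≗ = col , replicate≤tabulate (n / suc k) (sizes col)
          (λ j → subst (n / suc k ≤_) (sym (sizes≗ j)) (⌊n/K⌋≤balancedSizes k n j))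

module RationalArithmetic where

  open import Data.Nat as ℕ using (ℕ; suc)
  import Data.Nat.Properties as ℕP
  open import Data.Integer as ℤ using (+_)
  import Data.Integer.Properties as ℤP
  open import Data.Rational
  open import Data.Rational.Properties
  open import Data.Rational.Literals using (fromℤ)
  import Data.Rational.Unnormalised as ℚᵘ
  import Data.Rational.Unnormalised.Properties as ℚᵘP
  open import Relation.Binary.PropositionalEquality
  open import Defs using (ratio)

  fromℚᵘ-+ : ∀ p q → fromℚᵘ (p ℚᵘ.+ q) ≡ fromℚᵘ p + fromℚᵘ q
  fromℚᵘ-+ p q = toℚᵘ-injective (ℚᵘP.≃-trans (toℚᵘ-fromℚᵘ (p ℚᵘ.+ q))
    (ℚᵘP.≃-sym (ℚᵘP.≃-trans (toℚᵘ-homo-+ (fromℚᵘ p) (fromℚᵘ q))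
      (ℚᵘP.+-cong (toℚᵘ-fromℚᵘ p) (toℚᵘ-fromℚᵘ q)))))

  fromℚᵘ-* : ∀ p q → fromℚᵘ (p ℚᵘ.* q) ≡ fromℚᵘ p * fromℚᵘ q
  fromℚᵘ-* p q = toℚᵘ-injective (ℚᵘP.≃-trans (toℚᵘ-fromℚᵘ (p ℚᵘ.* q))
    (ℚᵘP.≃-sym (ℚᵘP.≃-trans (toℚᵘ-homo-* (fromℚᵘ p) (fromℚᵘ q))
      (ℚᵘP.*-cong (toℚᵘ-fromℚᵘ p) (toℚᵘ-fromℚᵘ q)))))

  fromℚᵘ-mono-≤ : ∀ {p q} → p ℚᵘ.≤ q → fromℚᵘ p ≤ fromℚᵘ q
  fromℚᵘ-mono-≤ {p} {q} h = toℚᵘ-cancel-≤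
    (ℚᵘP.≤-respˡ-≃ (ℚᵘP.≃-sym (toℚᵘ-fromℚᵘ p)) (ℚᵘP.≤-respʳ-≃ (ℚᵘP.≃-sym (toℚᵘ-fromℚᵘ q)) h))

  toℚ : ℕ → ℚ
  toℚ n = fromℤ (+ n)

  ratio-1 : ∀ n → ratio n 1 ≡ toℚ n
  ratio-1 n = fromℚᵘ-toℚᵘ (toℚ n)

  -- ratio m (suc d) is fromℚᵘ (mkℚᵘ (+ m) d) by definition.
  ratio-cross : ∀ x a y b → x ℕ.* suc b ≡ y ℕ.* suc a → ratio x (suc a) ≡ ratio y (suc b)
  ratio-cross x a y b e = fromℚᵘ-cong {ℚᵘ.mkℚᵘ (+ x) a} {ℚᵘ.mkℚᵘ (+ y) b}
    (ℚᵘ.*≡* (trans (sym (ℤP.pos-* x (suc b))) (trans (cong +_ e) (ℤP.pos-* y (suc a)))))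

  ratio-* : ∀ x a y b → ratio x (suc a) * ratio y (suc b) ≡ ratio (x ℕ.* y) (suc a ℕ.* suc b)
  ratio-* x a y b = trans (sym (fromℚᵘ-* (ℚᵘ.mkℚᵘ (+ x) a) (ℚᵘ.mkℚᵘ (+ y) b)))
    (fromℚᵘ-cong {ℚᵘ.mkℚᵘ (+ x) a ℚᵘ.* ℚᵘ.mkℚᵘ (+ y) b} {ℚᵘ.mkℚᵘ (+ (x ℕ.* y)) (b ℕ.+ a ℕ.* suc b)}
      (ℚᵘ.*≡* (cong (ℤ._* + (suc a ℕ.* suc b)) (sym (ℤP.pos-* x y)))))

  ratio-+ : ∀ x y a → ratio x (suc a) + ratio y (suc a) ≡ ratio (x ℕ.+ y) (suc a)
  ratio-+ x y a = trans (sym (fromℚᵘ-+ (ℚᵘ.mkℚᵘ (+ x) a) (ℚᵘ.mkℚᵘ (+ y) a)))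
    (fromℚᵘ-cong {ℚᵘ.mkℚᵘ (+ x) a ℚᵘ.+ ℚᵘ.mkℚᵘ (+ y) a} {ℚᵘ.mkℚᵘ (+ (x ℕ.+ y)) a} (ℚᵘ.*≡* cross))
    where
    cross : (+ x ℤ.* + suc a ℤ.+ + y ℤ.* + suc a) ℤ.* + suc a ≡ + (x ℕ.+ y) ℤ.* + (suc a ℕ.* suc a)
    cross = trans (cong (ℤ._* + suc a) (sym (ℤP.*-distribʳ-+ (+ suc a) (+ x) (+ y))))
      (trans (ℤP.*-assoc (+ x ℤ.+ + y) (+ suc a) (+ suc a))
        (cong₂ ℤ._*_ (sym (ℤP.pos-+ x y)) (sym (ℤP.pos-* (suc a) (suc a)))))

  ratio-mono-≤ : ∀ {x y} a → x ℕ.≤ y → ratio x (suc a) ≤ ratio y (suc a)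
  ratio-mono-≤ {x} {y} a h = fromℚᵘ-mono-≤ {ℚᵘ.mkℚᵘ (+ x) a} {ℚᵘ.mkℚᵘ (+ y) a}
    (ℚᵘ.*≤* (subst₂ ℤ._≤_ (ℤP.pos-* x (suc a)) (ℤP.pos-* y (suc a)) (ℤ.+≤+ (ℕP.*-monoˡ-≤ (suc a) h))))

  ratio-self : ∀ a → ratio (suc a) (suc a) ≡ 1ℚ
  ratio-self a = ratio-cross (suc a) a 1 0 (trans (ℕP.*-identityʳ (suc a)) (sym (ℕP.*-identityˡ (suc a))))

  ratio-zero : ∀ a → ratio 0 (suc a) ≡ 0ℚ
  ratio-zero a = ratio-cross 0 a 0 0 refl

  toℚ-+ : ∀ m n → toℚ (m ℕ.+ n) ≡ toℚ m + toℚ n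
  toℚ-+ m n = begin
    toℚ (m ℕ.+ n)             ≡⟨ ratio-1 (m ℕ.+ n) ⟨
    ratio (m ℕ.+ n) 1         ≡⟨ ratio-+ m n 0 ⟨
    ratio m 1 + ratio n 1     ≡⟨ cong₂ _+_ (ratio-1 m) (ratio-1 n) ⟩
    toℚ m + toℚ n             ∎
    where open ≡-Reasoning

  toℚ-* : ∀ m n → toℚ (m ℕ.* n) ≡ toℚ m * toℚ n
  toℚ-* m n = begin
    toℚ (m ℕ.* n)             ≡⟨ ratio-1 (m ℕ.* n) ⟨
    ratio (m ℕ.* n) 1         ≡⟨ ratio-* m 0 n 0 ⟨
    ratio m 1 * ratio n 1     ≡⟨ cong₂ _*_ (ratio-1 m) (ratio-1 n) ⟩
    toℚ m * toℚ n             ∎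
    where open ≡-Reasoning

  toℚ-mono-≤ : ∀ {m n} → m ℕ.≤ n → toℚ m ≤ toℚ n
  toℚ-mono-≤ {m} {n} h = subst₂ _≤_ (ratio-1 m) (ratio-1 n) (ratio-mono-≤ 0 h)

  *-cancelʳ-≤-toℚ : ∀ m {x y} → x * toℚ (suc m) ≤ y * toℚ (suc m) → x ≤ y
  *-cancelʳ-≤-toℚ m {x} {y} h = toℚᵘ-cancel-≤ (ℚᵘP.*-cancelʳ-≤-pos (ℚᵘ.mkℚᵘ (+ suc m) 0)
    (ℚᵘP.≤-respˡ-≃ (toℚᵘ-homo-* x (toℚ (suc m)))
      (ℚᵘP.≤-respʳ-≃ (toℚᵘ-homo-* y (toℚ (suc m))) (toℚᵘ-mono-≤ h))))

module Limits where

  open import Data.Nat as ℕ using (ℕ; zero; suc)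
  import Data.Nat.Properties as ℕP
  open import Data.Integer as ℤ using (+_)
  import Data.Integer.Properties as ℤP
  open import Data.Rational hiding (_⊔_; _⊓_)
  open import Data.Rational.Properties
  open import Data.Rational.Solver using (module +-*-Solver)
  import Data.Rational.Unnormalised as ℚᵘ
  import Data.Rational.Unnormalised.Properties as ℚᵘP
  open import Data.Product using (∃; _,_; proj₁; proj₂)
  open import Data.Empty using (⊥-elim)
  open import Relation.Nullary using (yes; no)
  open import Relation.Binary.PropositionalEquality
  open import Defs using (ratio)
  open RationalArithmetic
  open +-*-Solver

  infix 4 _⟶_

  -- Convergence, with precisions 1 / (d + 1) to avoid rational division.
  record _⟶_ (u : ℕ → ℚ) (L : ℚ) : Set where
    constructor converges
    field modulus : ∀ d → ∃ λ N → ∀ n → N ℕ.≤ n → ∣ u n - L ∣ * toℚ (suc d) ≤ 1ℚ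

  ⟶-const : ∀ L → (λ _ → L) ⟶ L
  ⟶-const L = converges λ d → 0 , λ _ _ → begin
    ∣ L - L ∣ * toℚ (suc d) ≡⟨ cong (_* toℚ (suc d)) {y = 0ℚ} (cong ∣_∣ (+-inverseʳ L)) ⟩
    0ℚ * toℚ (suc d)        ≡⟨ *-zeroˡ (toℚ (suc d)) ⟩
    0ℚ                      ≤⟨ toℚ-mono-≤ {0} {1} ℕ.z≤n ⟩
    1ℚ                      ∎
    where open ≤-Reasoning

  ⟶-eventually : ∀ {u v L} N₀ → (∀ n → N₀ ℕ.≤ n → u n ≡ v n) → u ⟶ L → v ⟶ L
  ⟶-eventually {L = L} N₀ e (converges hu) = converges λ d → N₀ ℕ.⊔ proj₁ (hu d) , λ n le →
    subst (λ z → ∣ z - L ∣ * toℚ (suc d) ≤ 1ℚ) (e n (ℕP.m⊔n≤o⇒m≤o N₀ _ le))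
      (proj₂ (hu d) n (ℕP.m⊔n≤o⇒n≤o N₀ _ le))

  halves : ∀ d {x y} → x * toℚ (suc d ℕ.+ suc d) ≤ 1ℚ → y * toℚ (suc d ℕ.+ suc d) ≤ 1ℚ →
    (x + y) * toℚ (suc d) ≤ 1ℚ
  halves d {x} {y} hx hy = *-cancelʳ-≤-toℚ 1 (begin
    (x + y) * c * toℚ 2                               ≡⟨ solve 3 (λ x y c → (x :+ y) :* c :* (con 1ℚ :+ con 1ℚ)
                                                           := x :* (c :+ c) :+ y :* (c :+ c)) refl x y c ⟩
    x * (c + c) + y * (c + c)                         ≡⟨ cong (λ z → x * z + y * z) (toℚ-+ (suc d) (suc d)) ⟨
    x * toℚ (suc d ℕ.+ suc d) + y * toℚ (suc d ℕ.+ suc d) ≤⟨ +-mono-≤ hx hy ⟩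
    1ℚ * toℚ 2                                        ∎)
    where
    open ≤-Reasoning
    c = toℚ (suc d)

  ⟶-- : ∀ {u v a b} → u ⟶ a → v ⟶ b → (λ n → u n - v n) ⟶ a - b
  ⟶-- {u} {v} {a} {b} (converges hu) (converges hv) = converges λ d →
    let d′ = d ℕ.+ suc d
        N₁ = proj₁ (hu d′)
        N₂ = proj₁ (hv d′)
    in N₁ ℕ.⊔ N₂ , λ n le → difference-close {u n} {v n} d
         (proj₂ (hu d′) n (ℕP.m⊔n≤o⇒m≤o N₁ N₂ le)) (proj₂ (hv d′) n (ℕP.m⊔n≤o⇒n≤o N₁ N₂ le))
    where
    difference-close : ∀ {x y} d →
      ∣ x - a ∣ * toℚ (suc d ℕ.+ suc d) ≤ 1ℚ → ∣ y - b ∣ * toℚ (suc d ℕ.+ suc d) ≤ 1ℚ →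
      ∣ (x - y) - (a - b) ∣ * toℚ (suc d) ≤ 1ℚ
    difference-close {x} {y} d hx hy = begin
      ∣ (x - y) - (a - b) ∣ * toℚ (suc d)
        ≡⟨ cong (λ z → ∣ z ∣ * toℚ (suc d))
             (solve 4 (λ x y a b → (x :- y) :- (a :- b) := (x :- a) :- (y :- b)) refl x y a b) ⟩
      ∣ (x - a) - (y - b) ∣ * toℚ (suc d)
        ≤⟨ *-monoʳ-≤-nonNeg (toℚ (suc d)) (∣p-q∣≤∣p∣+∣q∣ (x - a) (y - b)) ⟩
      (∣ x - a ∣ + ∣ y - b ∣) * toℚ (suc d)
        ≤⟨ halves d {∣ x - a ∣} {∣ y - b ∣} hx hy ⟩
      1ℚ ∎
      where open ≤-Reasoning

  ∣∣≤toℚ : ∀ p → ∃ λ B → ∣ p ∣ ≤ toℚ B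
  ∣∣≤toℚ (mkℚ n d _) = ℤ.∣ n ∣ , *≤* (subst₂ ℤ._≤_ (ℤP.pos-* ℤ.∣ n ∣ 1) (ℤP.pos-* ℤ.∣ n ∣ (suc d))
    (ℤ.+≤+ (ℕP.*-monoʳ-≤ ℤ.∣ n ∣ (ℕ.s≤s ℕ.z≤n))))

  ≤1-if-scaled-≤1 : ∀ {x} → .{{_ : NonNegative x}} → ∀ D → x * toℚ (suc D) ≤ 1ℚ → x ≤ 1ℚ
  ≤1-if-scaled-≤1 {x} D h =
    ≤-trans (≤-reflexive (sym (*-identityʳ x))) (≤-trans (*-monoˡ-≤-nonNeg x (toℚ-mono-≤ (ℕ.s≤s ℕ.z≤n))) h)

  product-error : ∀ u v a b →
    ∣ u * v - a * b ∣ ≤ ∣ u - a ∣ * ∣ v - b ∣ + ∣ a ∣ * ∣ v - b ∣ + ∣ b ∣ * ∣ u - a ∣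
  product-error u v a b = begin
    ∣ u * v - a * b ∣
      ≡⟨ cong ∣_∣ (solve 4 (λ u v a b → u :* v :- a :* b
           := (u :- a) :* (v :- b) :+ a :* (v :- b) :+ b :* (u :- a)) refl u v a b) ⟩
    ∣ (u - a) * (v - b) + a * (v - b) + b * (u - a) ∣
      ≤⟨ ∣p+q∣≤∣p∣+∣q∣ ((u - a) * (v - b) + a * (v - b)) (b * (u - a)) ⟩
    ∣ (u - a) * (v - b) + a * (v - b) ∣ + ∣ b * (u - a) ∣
      ≤⟨ +-monoˡ-≤ ∣ b * (u - a) ∣ (∣p+q∣≤∣p∣+∣q∣ ((u - a) * (v - b)) (a * (v - b))) ⟩
    ∣ (u - a) * (v - b) ∣ + ∣ a * (v - b) ∣ + ∣ b * (u - a) ∣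
      ≡⟨ cong₂ _+_ (cong₂ _+_ (∣p*q∣≡∣p∣*∣q∣ (u - a) (v - b)) (∣p*q∣≡∣p∣*∣q∣ a (v - b)))
                   (∣p*q∣≡∣p∣*∣q∣ b (u - a)) ⟩
    ∣ u - a ∣ * ∣ v - b ∣ + ∣ a ∣ * ∣ v - b ∣ + ∣ b ∣ * ∣ u - a ∣ ∎
    where open ≤-Reasoning

  -- Precision (2B + 1)(d + 1) on both factors gives precision d + 1 on the product.
  product-close : ∀ {u v a b} B d → ∣ a ∣ ≤ toℚ B → ∣ b ∣ ≤ toℚ B →
    ∣ u - a ∣ * toℚ (suc (d ℕ.+ 2 ℕ.* B ℕ.* suc d)) ≤ 1ℚ →
    ∣ v - b ∣ * toℚ (suc (d ℕ.+ 2 ℕ.* B ℕ.* suc d)) ≤ 1ℚ →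
    ∣ u * v - a * b ∣ * toℚ (suc d) ≤ 1ℚ
  product-close {u} {v} {a} {b} B d ∣a∣≤B ∣b∣≤B hx hy = *-cancelʳ-≤-toℚ (2 ℕ.* B) (begin
    ∣ u * v - a * b ∣ * toℚ (suc d) * toℚ (suc (2 ℕ.* B))
      ≡⟨ trans (*-assoc ∣ u * v - a * b ∣ (toℚ (suc d)) (toℚ (suc (2 ℕ.* B))))
           (cong (∣ u * v - a * b ∣ *_) (trans (*-comm (toℚ (suc d)) (toℚ (suc (2 ℕ.* B))))
             (sym (toℚ-* (suc (2 ℕ.* B)) (suc d))))) ⟩
    ∣ u * v - a * b ∣ * D
      ≤⟨ *-monoʳ-≤-nonNeg D (product-error u v a b) ⟩
    (x * y + ∣ a ∣ * y + ∣ b ∣ * x) * D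
      ≡⟨ solve 5 (λ x y A B D → (x :* y :+ A :* y :+ B :* x) :* D
           := x :* (y :* D) :+ A :* (y :* D) :+ B :* (x :* D)) refl x y ∣ a ∣ ∣ b ∣ D ⟩
    x * (y * D) + ∣ a ∣ * (y * D) + ∣ b ∣ * (x * D)
      ≤⟨ +-mono-≤ (+-mono-≤ (*-monoˡ-≤-nonNeg x {{∣-∣-nonNeg (u - a)}} hy)
                            (*-monoˡ-≤-nonNeg ∣ a ∣ {{∣-∣-nonNeg a}} hy))
                  (*-monoˡ-≤-nonNeg ∣ b ∣ {{∣-∣-nonNeg b}} hx) ⟩
    x * 1ℚ + ∣ a ∣ * 1ℚ + ∣ b ∣ * 1ℚ
      ≡⟨ cong₂ _+_ (cong₂ _+_ (*-identityʳ x) (*-identityʳ ∣ a ∣)) (*-identityʳ ∣ b ∣) ⟩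
    x + ∣ a ∣ + ∣ b ∣
      ≤⟨ +-mono-≤ (+-mono-≤ (≤1-if-scaled-≤1 {x} {{∣-∣-nonNeg (u - a)}} _ hx) ∣a∣≤B) ∣b∣≤B ⟩
    1ℚ + toℚ B + toℚ B
      ≡⟨ trans (cong (_+ toℚ B) (sym (toℚ-+ 1 B))) (sym (toℚ-+ (1 ℕ.+ B) B)) ⟩
    toℚ (1 ℕ.+ B ℕ.+ B)
      ≡⟨ cong (λ z → toℚ (suc (B ℕ.+ z))) (sym (ℕP.+-identityʳ B)) ⟩
    toℚ (suc (2 ℕ.* B))
      ≡⟨ *-identityˡ (toℚ (suc (2 ℕ.* B))) ⟨
    1ℚ * toℚ (suc (2 ℕ.* B)) ∎)
    where
    open ≤-Reasoning
    D = toℚ (suc (d ℕ.+ 2 ℕ.* B ℕ.* suc d))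
    x = ∣ u - a ∣
    y = ∣ v - b ∣

  ⟶-* : ∀ {u v a b} → u ⟶ a → v ⟶ b → (λ n → u n * v n) ⟶ a * b
  ⟶-* {u} {v} {a} {b} (converges hu) (converges hv) = converges λ d →
    let d′ = d ℕ.+ 2 ℕ.* B ℕ.* suc d
        N₁ = proj₁ (hu d′)
        N₂ = proj₁ (hv d′)
    in N₁ ℕ.⊔ N₂ , λ n le → product-close {u n} {v n} B d ∣a∣≤B ∣b∣≤B
         (proj₂ (hu d′) n (ℕP.m⊔n≤o⇒m≤o N₁ N₂ le)) (proj₂ (hv d′) n (ℕP.m⊔n≤o⇒n≤o N₁ N₂ le))
    where
    B = proj₁ (∣∣≤toℚ a) ℕ.+ proj₁ (∣∣≤toℚ b)
    ∣a∣≤B : ∣ a ∣ ≤ toℚ B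
    ∣a∣≤B = ≤-trans (proj₂ (∣∣≤toℚ a)) (toℚ-mono-≤ (ℕP.m≤m+n _ _))
    ∣b∣≤B : ∣ b ∣ ≤ toℚ B
    ∣b∣≤B = ≤-trans (proj₂ (∣∣≤toℚ b)) (toℚ-mono-≤ (ℕP.m≤n+m _ (proj₁ (∣∣≤toℚ a))))

  private
    toℚᵘ-- : ∀ p q → toℚᵘ (fromℚᵘ p - fromℚᵘ q) ℚᵘ.≃ p ℚᵘ.- q
    toℚᵘ-- p q = ℚᵘP.≃-trans (toℚᵘ-homo-+ (fromℚᵘ p) (- fromℚᵘ q))
      (ℚᵘP.+-cong (toℚᵘ-fromℚᵘ p) (ℚᵘP.≃-trans (toℚᵘ-homo‿- (fromℚᵘ q)) (ℚᵘP.-‿cong (toℚᵘ-fromℚᵘ q))))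

  ratio-close : ∀ u w j k d B → ℤ.∣ + (suc k ℕ.* u) ℤ.- + (j ℕ.* suc w) ∣ ℕ.≤ B → B ℕ.* suc d ℕ.≤ w →
    ∣ ratio u (suc w) - ratio j (suc k) ∣ * toℚ (suc d) ≤ 1ℚ
  ratio-close u w j k d B bounded large = toℚᵘ-cancel-≤ (ℚᵘP.≤-respˡ-≃ (ℚᵘP.≃-sym scaled) (ℚᵘ.*≤* cross))
    where
    p = ℚᵘ.mkℚᵘ (+ u) w
    q = ℚᵘ.mkℚᵘ (+ j) k
    scaled : toℚᵘ (∣ fromℚᵘ p - fromℚᵘ q ∣ * toℚ (suc d)) ℚᵘ.≃
             ℚᵘ.∣ p ℚᵘ.- q ∣ ℚᵘ.* ℚᵘ.mkℚᵘ (+ suc d) 0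
    scaled = ℚᵘP.≃-trans (toℚᵘ-homo-* ∣ fromℚᵘ p - fromℚᵘ q ∣ (toℚ (suc d)))
      (ℚᵘP.*-cong (ℚᵘP.≃-trans (toℚᵘ-homo-∣-∣ (fromℚᵘ p - fromℚᵘ q)) (ℚᵘP.∣-∣-cong (toℚᵘ-- p q)))
        ℚᵘP.≃-refl)
    X = + u ℤ.* + suc k ℤ.+ (ℤ.- + j) ℤ.* + suc w
    X≡ : X ≡ + (suc k ℕ.* u) ℤ.- + (j ℕ.* suc w)
    X≡ = trans (cong₂ ℤ._+_ (ℤP.*-comm (+ u) (+ suc k)) (sym (ℤP.neg-distribˡ-* (+ j) (+ suc w))))
           (cong₂ ℤ._-_ (sym (ℤP.pos-* (suc k) u)) (sym (ℤP.pos-* j (suc w))))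
    cross-ℕ : ℤ.∣ X ∣ ℕ.* suc d ℕ.* 1 ℕ.≤ 1 ℕ.* (suc w ℕ.* suc k ℕ.* 1)
    cross-ℕ = begin
      ℤ.∣ X ∣ ℕ.* suc d ℕ.* 1      ≡⟨ ℕP.*-identityʳ _ ⟩
      ℤ.∣ X ∣ ℕ.* suc d            ≤⟨ ℕP.*-monoˡ-≤ (suc d) (subst (λ z → ℤ.∣ z ∣ ℕ.≤ B) (sym X≡) bounded) ⟩
      B ℕ.* suc d                  ≤⟨ ℕP.≤-trans large (ℕP.n≤1+n w) ⟩
      suc w                        ≤⟨ ℕP.m≤m*n (suc w) (suc k) ⟩
      suc w ℕ.* suc k              ≡⟨ trans (sym (ℕP.*-identityʳ _)) (sym (ℕP.+-identityʳ _)) ⟩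
      1 ℕ.* (suc w ℕ.* suc k ℕ.* 1) ∎
      where open ℕP.≤-Reasoning
    cross = subst₂ ℤ._≤_ (trans (ℤP.pos-* (ℤ.∣ X ∣ ℕ.* suc d) 1) (cong (ℤ._* + 1) (ℤP.pos-* ℤ.∣ X ∣ (suc d))))
              (ℤP.pos-* 1 (suc w ℕ.* suc k ℕ.* 1)) (ℤ.+≤+ cross-ℕ)

  ratio-⟶ : ∀ (u w : ℕ → ℕ) j k N₀ B c →
    (∀ n → N₀ ℕ.≤ n → ℤ.∣ + (suc k ℕ.* u n) ℤ.- + (j ℕ.* w n) ∣ ℕ.≤ B) →
    (∀ n → N₀ ℕ.≤ n → n ℕ.≤ w n ℕ.+ c) →
    (λ n → ratio (u n) (w n)) ⟶ ratio j (suc k)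
  ratio-⟶ u w j k N₀ B c bounded growing = converges λ d → N₀ ℕ.⊔ (B ℕ.* suc d ℕ.+ suc c) , λ n le →
      close d n (ℕP.m⊔n≤o⇒m≤o N₀ _ le) (ℕP.m⊔n≤o⇒n≤o N₀ _ le) (w n) refl
    where
    close : ∀ d n → N₀ ℕ.≤ n → B ℕ.* suc d ℕ.+ suc c ℕ.≤ n → ∀ m → w n ≡ m →
      ∣ ratio (u n) (w n) - ratio j (suc k) ∣ * toℚ (suc d) ≤ 1ℚ
    close d n l₀ l₁ zero    e = ⊥-elim (ℕP.<⇒≱ (ℕP.≤-trans (ℕP.m≤n+m (suc c) (B ℕ.* suc d)) l₁)
                                              (subst (λ z → n ℕ.≤ z ℕ.+ c) e (growing n l₀)))
    close d n l₀ l₁ (suc m) e rewrite e = ratio-close (u n) m j k d B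
      (subst (λ z → ℤ.∣ + (suc k ℕ.* u n) ℤ.- + (j ℕ.* z) ∣ ℕ.≤ B) e (bounded n l₀))
      (ℕP.+-cancelʳ-≤ (suc c) _ _ (ℕP.≤-trans l₁ (ℕP.≤-trans (subst (λ z → n ℕ.≤ z ℕ.+ c) e (growing n l₀))
        (ℕP.≤-reflexive (sym (ℕP.+-suc m c))))))

  ⟶⇒within : ∀ {u L} → u ⟶ L → ∀ ε → 0ℚ < ε → ∃ λ N → ∀ n → N ℕ.≤ n → ∣ u n - L ∣ < ε
  ⟶⇒within _ ε@(mkℚ (+ zero)  q _) (*<* (ℤ.+<+ ()))
  ⟶⇒within _ ε@(mkℚ ℤ.-[1+ _ ] q _) (*<* ())
  ⟶⇒within {u} {L} (converges hu) ε@(mkℚ ℤ.+[1+ p ] q _) _ =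
    proj₁ (hu (suc q)) , λ n le → below (∣ u n - L ∣) (proj₂ (hu (suc q)) n le)
    where
    big : 1ℚ < ε * toℚ (suc (suc q))
    big = toℚᵘ-cancel-< (ℚᵘP.<-respʳ-≃ (ℚᵘP.≃-sym (toℚᵘ-homo-* ε (toℚ (suc (suc q))))) (ℚᵘ.*<* cross))
      where
      cross-ℕ : 1 ℕ.* (suc q ℕ.* 1) ℕ.< suc p ℕ.* suc (suc q) ℕ.* 1
      cross-ℕ = subst₂ ℕ._<_ (sym (trans (ℕP.*-identityˡ _) (ℕP.*-identityʳ _))) (sym (ℕP.*-identityʳ _))
        (ℕP.<-≤-trans (ℕP.n<1+n (suc q)) (ℕP.m≤n*m (suc (suc q)) (suc p)))
      cross : + 1 ℤ.* + (suc q ℕ.* 1) ℤ.< + (suc p) ℤ.* + (suc (suc q)) ℤ.* + 1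
      cross = subst₂ ℤ._<_ (ℤP.pos-* 1 (suc q ℕ.* 1))
        (trans (ℤP.pos-* (suc p ℕ.* suc (suc q)) 1) (cong (ℤ._* + 1) (ℤP.pos-* (suc p) (suc (suc q)))))
        (ℤ.+<+ cross-ℕ)
    below : ∀ y → y * toℚ (suc (suc q)) ≤ 1ℚ → y < ε
    below y h with y <? ε
    ... | yes y<ε = y<ε
    ... | no  y≮ε = ⊥-elim (<-irrefl refl
            (<-≤-trans big (≤-trans (*-monoʳ-≤-nonNeg (toℚ (suc (suc q))) (≮⇒≥ y≮ε)) h)))

module BinomialRatio where

  open import Data.Nat as ℕ using (ℕ; zero; suc; _∸_; _/_; _%_)
  import Data.Nat.Properties as ℕP
  open import Data.Nat.DivMod using (m≡m%n+[m/n]*n; m%n<n; m*n/n≡m; /-monoˡ-≤)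
  open import Data.Integer as ℤ using (+_)
  import Data.Integer.Properties as ℤP
  open import Data.Integer.Solver using (module +-*-Solver)
  open import Data.Rational using (_*_)
  open import Data.Rational.Properties using (*-comm)
  open import Data.Empty using (⊥-elim)
  open import Relation.Binary.PropositionalEquality
  open import Defs using (ratio; _^ℚ_)
  open Binomial
  open RationalArithmetic
  open Limits
  open +-*-Solver

  choose-ratio-step : ∀ a n r → r ℕ.< n →
    ratio (choose a (suc r)) (choose n (suc r)) ≡ ratio (choose a r) (choose n r) * ratio (a ∸ r) (n ∸ r)
  choose-ratio-step a n r r<n = go (choose n r) refl (n ∸ r) refl (choose n (suc r)) refl
    where
    go : ∀ c₀ → choose n r ≡ c₀ → ∀ m → n ∸ r ≡ m → ∀ c₁ → choose n (suc r) ≡ c₁ →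
      ratio (choose a (suc r)) c₁ ≡ ratio (choose a r) c₀ * ratio (a ∸ r) m
    go zero     e₀ _       _  _        _  = ⊥-elim (ℕP.<⇒≱ (k≤n⇒0<choose (ℕP.<⇒≤ r<n)) (ℕP.≤-reflexive e₀))
    go (suc c₀) e₀ zero    eₘ _        _  = ⊥-elim (ℕP.<⇒≱ (ℕP.m<n⇒0<n∸m r<n) (ℕP.≤-reflexive eₘ))
    go (suc c₀) e₀ (suc m) eₘ zero     e₁ = ⊥-elim (ℕP.<⇒≱ (k≤n⇒0<choose r<n) (ℕP.≤-reflexive e₁))
    go (suc c₀) e₀ (suc m) eₘ (suc c₁) e₁ =
      sym (trans (ratio-* (choose a r) c₀ (a ∸ r) m)
        (ratio-cross (choose a r ℕ.* (a ∸ r)) (m ℕ.+ c₀ ℕ.* suc m) (choose a (suc r)) c₁ cross))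
      where
      open ≡-Reasoning
      denominators : suc c₁ ℕ.* suc r ≡ suc c₀ ℕ.* suc m
      denominators = trans (cong (ℕ._* suc r) (sym e₁)) (trans (choose-suc-* n r) (cong₂ ℕ._*_ e₀ eₘ))
      cross : choose a r ℕ.* (a ∸ r) ℕ.* suc c₁ ≡ choose a (suc r) ℕ.* (suc c₀ ℕ.* suc m)
      cross = begin
        choose a r ℕ.* (a ∸ r) ℕ.* suc c₁         ≡⟨ cong (ℕ._* suc c₁) (choose-suc-* a r) ⟨
        choose a (suc r) ℕ.* suc r ℕ.* suc c₁     ≡⟨ ℕP.*-assoc (choose a (suc r)) (suc r) (suc c₁) ⟩
        choose a (suc r) ℕ.* (suc r ℕ.* suc c₁)   ≡⟨ cong (choose a (suc r) ℕ.*_)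
                                                       (trans (ℕP.*-comm (suc r) (suc c₁)) denominators) ⟩
        choose a (suc r) ℕ.* (suc c₀ ℕ.* suc m)   ∎

  crossBound : ℕ → ℕ → ℕ → ℕ → ℕ
  crossBound k e l j = j ℕ.* suc k ℕ.* e ℕ.+ suc k ℕ.* l ℕ.+ j ℕ.* suc k ℕ.+ j ℕ.* l

  private
    +∸ : ∀ {m n} → n ℕ.≤ m → + (m ∸ n) ≡ + m ℤ.- + n
    +∸ {m} {n} n≤m = sym (trans (ℤP.m-n≡m⊖n m n) (ℤP.⊖-≥ n≤m))

    ∣a-b-c+d∣≤ : ∀ a b c d →
      ℤ.∣ a ℤ.- b ℤ.- c ℤ.+ d ∣ ℕ.≤ ℤ.∣ a ∣ ℕ.+ ℤ.∣ b ∣ ℕ.+ ℤ.∣ c ∣ ℕ.+ ℤ.∣ d ∣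
    ∣a-b-c+d∣≤ a b c d = ℕP.≤-trans (ℤP.∣i+j∣≤∣i∣+∣j∣ (a ℤ.- b ℤ.- c) d)
      (ℕP.+-monoˡ-≤ ℤ.∣ d ∣ (ℕP.≤-trans (ℤP.∣i-j∣≤∣i∣+∣j∣ (a ℤ.- b) c)
        (ℕP.+-monoˡ-≤ ℤ.∣ c ∣ (ℤP.∣i-j∣≤∣i∣+∣j∣ a b))))

  -- Writing n = s + q K with s < K, the difference is K j e − K l − j s + j l.
  cross-bounded : ∀ k e l j n → suc k ℕ.* l ℕ.≤ n →
    ℤ.∣ + (suc k ℕ.* (j ℕ.* (n / suc k ℕ.+ e) ∸ l)) ℤ.- + (j ℕ.* (n ∸ l)) ∣ ℕ.≤ crossBound k e l j
  cross-bounded k e l zero n _ =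
    subst (λ z → ℤ.∣ + z ℤ.- + 0 ∣ ℕ.≤ crossBound k e l 0)
      (sym (trans (cong (suc k ℕ.*_) (ℕP.0∸n≡0 l)) (ℕP.*-zeroʳ (suc k)))) ℕ.z≤n
  cross-bounded k e l j@(suc _) n Kl≤n =
    ℕP.≤-trans (ℕP.≤-reflexive (cong ℤ.∣_∣ difference))
      (ℕP.≤-trans (∣a-b-c+d∣≤ (+ (K ℕ.* j ℕ.* e)) (+ (K ℕ.* l)) (+ (j ℕ.* s)) (+ (j ℕ.* l))) bound)
    where
    K = suc k
    q = n / K
    s = n % K
    l≤q : l ℕ.≤ q
    l≤q = subst (ℕ._≤ q) (m*n/n≡m l K) (/-monoˡ-≤ K (subst (ℕ._≤ n) (ℕP.*-comm K l) Kl≤n))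
    l≤j[q+e] : l ℕ.≤ j ℕ.* (q ℕ.+ e)
    l≤j[q+e] = ℕP.≤-trans l≤q (ℕP.≤-trans (ℕP.m≤m+n q e) (ℕP.m≤n*m (q ℕ.+ e) j))
    l≤n : l ℕ.≤ n
    l≤n = ℕP.≤-trans (ℕP.m≤n*m l K) Kl≤n
    difference : + (K ℕ.* (j ℕ.* (q ℕ.+ e) ∸ l)) ℤ.- + (j ℕ.* (n ∸ l))
               ≡ + (K ℕ.* j ℕ.* e) ℤ.- + (K ℕ.* l) ℤ.- + (j ℕ.* s) ℤ.+ + (j ℕ.* l)
    difference = begin
      + (K ℕ.* (j ℕ.* (q ℕ.+ e) ∸ l)) ℤ.- + (j ℕ.* (n ∸ l))
        ≡⟨ cong₂ ℤ._-_ (trans (ℤP.pos-* K _) (cong ((+ K) ℤ.*_) (trans (+∸ l≤j[q+e])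
                          (cong (ℤ._- + l) (trans (ℤP.pos-* j (q ℕ.+ e)) (cong ((+ j) ℤ.*_) (ℤP.pos-+ q e)))))))
                       (trans (ℤP.pos-* j (n ∸ l)) (cong ((+ j) ℤ.*_) (trans (+∸ l≤n)
                          (cong (ℤ._- + l) (trans (cong +_ (m≡m%n+[m/n]*n n K))
                            (trans (ℤP.pos-+ s (q ℕ.* K)) (cong (λ z → + s ℤ.+ z) (ℤP.pos-* q K)))))))) ⟩
      + K ℤ.* (+ j ℤ.* (+ q ℤ.+ + e) ℤ.- + l) ℤ.- + j ℤ.* (+ s ℤ.+ + q ℤ.* + K ℤ.- + l)
        ≡⟨ solve 6 (λ K j q e s l → K :* (j :* (q :+ e) :- l) :- j :* (s :+ q :* K :- l)
                                  := K :* j :* e :- K :* l :- j :* s :+ j :* l) refl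
             (+ K) (+ j) (+ q) (+ e) (+ s) (+ l) ⟩
      + K ℤ.* + j ℤ.* + e ℤ.- + K ℤ.* + l ℤ.- + j ℤ.* + s ℤ.+ + j ℤ.* + l
        ≡⟨ cong₂ ℤ._+_ (cong₂ ℤ._-_ (cong₂ ℤ._-_ (trans (ℤP.pos-* (K ℕ.* j) e) (cong (ℤ._* + e) (ℤP.pos-* K j)))
                                                 (ℤP.pos-* K l)) (ℤP.pos-* j s)) (ℤP.pos-* j l) ⟨
      + (K ℕ.* j ℕ.* e) ℤ.- + (K ℕ.* l) ℤ.- + (j ℕ.* s) ℤ.+ + (j ℕ.* l) ∎
      where open ≡-Reasoning
    bound : K ℕ.* j ℕ.* e ℕ.+ K ℕ.* l ℕ.+ j ℕ.* s ℕ.+ j ℕ.* l ℕ.≤ crossBound k e l j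
    bound = ℕP.+-monoˡ-≤ (j ℕ.* l) (ℕP.+-mono-≤
      (ℕP.+-monoˡ-≤ (K ℕ.* l) (ℕP.≤-reflexive (cong (ℕ._* e) (ℕP.*-comm K j))))
      (ℕP.*-monoʳ-≤ j (ℕP.<⇒≤ (m%n<n n K))))

  floor-ratio-⟶ : ∀ k j e l → (λ n → ratio (j ℕ.* (n / suc k ℕ.+ e) ∸ l) (n ∸ l)) ⟶ ratio j (suc k)
  floor-ratio-⟶ k j e l =
    ratio-⟶ (λ n → j ℕ.* (n / suc k ℕ.+ e) ∸ l) (λ n → n ∸ l) j k (suc k ℕ.* l) (crossBound k e l j) l
      (cross-bounded k e l j) (λ n _ → subst (n ℕ.≤_) (ℕP.+-comm l (n ∸ l)) (ℕP.m≤n+m∸n n l))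

  choose-ratio-⟶ : ∀ k j e r →
    (λ n → ratio (choose (j ℕ.* (n / suc k ℕ.+ e)) r) (choose n r)) ⟶ (ratio j (suc k) ^ℚ r)
  choose-ratio-⟶ k j e zero    = ⟶-const 1ℚ
    where open import Data.Rational using (1ℚ)
  choose-ratio-⟶ k j e (suc r) =
    ⟶-eventually (suc r) (λ n r<n → sym (choose-ratio-step (a n) n r r<n))
      (subst (λ L → (λ n → ratio (choose (a n) r) (choose n r) * ratio (a n ∸ r) (n ∸ r)) ⟶ L)
        (*-comm (ratio j (suc k) ^ℚ r) (ratio j (suc k)))
        (⟶-* (choose-ratio-⟶ k j e r) (floor-ratio-⟶ k j e r)))
    where a = λ n → j ℕ.* (n / suc k ℕ.+ e)

module InclusionExclusion where

  open import Data.Nat as ℕ using (ℕ; zero; suc; _∸_; _/_)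
  open import Data.List using (replicate)
  open import Data.Rational using (ℚ; _-_; _+_)
  open import Relation.Binary.PropositionalEquality
  open import Defs using (ratio; _^ℚ_)
  open Convolution
  open Binomial
  open Transversals
  open RationalArithmetic
  open Limits
  open BinomialRatio using (choose-ratio-⟶)
  open import Data.Rational.Solver using (module +-*-Solver)
  open +-*-Solver

  -- The coefficients of ((1 + z) ^ m − 1) ^ l · (1 + z) ^ (j m).
  mixed : ℕ → ℕ → ℕ → Seq
  mixed zero    j m = choose (j ℕ.* m)
  mixed (suc l) j m = choose⁺ m ⋆ mixed l j m

  mixed-transversals : ∀ l m → mixed l 0 m ≗ transversals (replicate l m)
  mixed-transversals zero    m = choose-zero
  mixed-transversals (suc l) m = ⋆-cong (λ _ → refl) (mixed-transversals l m)

  choose⋆mixed : ∀ l j m → choose m ⋆ mixed l j m ≗ mixed l (suc j) m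
  choose⋆mixed zero    j m = vandermonde m (j ℕ.* m)
  choose⋆mixed (suc l) j m t =
    trans (⋆-leftComm (choose m) (choose⁺ m) (mixed l j m) t) (⋆-cong (λ _ → refl) (choose⋆mixed l j m) t)

  mixed-suc : ∀ l j m t → mixed (suc l) j m t ℕ.+ mixed l j m t ≡ mixed l (suc j) m t
  mixed-suc l j m t = begin
    (choose⁺ m ⋆ mixed l j m) t ℕ.+ mixed l j m t        ≡⟨ cong ((choose⁺ m ⋆ mixed l j m) t ℕ.+_) (⋆-identityˡ _ t) ⟨
    (choose⁺ m ⋆ mixed l j m) t ℕ.+ (δ ⋆ mixed l j m) t  ≡⟨ ⋆-distribʳ-⊕ (choose⁺ m) δ (mixed l j m) t ⟨
    ((choose⁺ m ⊕ δ) ⋆ mixed l j m) t                    ≡⟨ ⋆-cong (choose≗choose⁺⊕δ m) (λ _ → refl) t ⟨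
    (choose m ⋆ mixed l j m) t                           ≡⟨ choose⋆mixed l j m t ⟩
    mixed l (suc j) m t                                  ∎
    where open ≡-Reasoning

  ratio-∸ : ∀ x y z w → x ℕ.+ y ≡ z → ratio x (suc w) ≡ ratio z (suc w) - ratio y (suc w)
  ratio-∸ x y z w e = begin
    ratio x (suc w)                                     ≡⟨ solve 2 (λ a b → a := a :+ b :- b) refl _ (ratio y (suc w)) ⟩
    ratio x (suc w) + ratio y (suc w) - ratio y (suc w) ≡⟨ cong (_- ratio y (suc w))
                                                             (trans (ratio-+ x y w) (cong (λ u → ratio u (suc w)) e)) ⟩
    ratio z (suc w) - ratio y (suc w)                   ∎
    where open ≡-Reasoning

  module _ (k r : ℕ) where

    power : ℕ → ℚ
    power x = ratio x (suc k) ^ℚ r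

    Δ : ℕ → ℕ → ℚ
    Δ zero    j = power j
    Δ (suc l) j = Δ l (suc j) - Δ l j

    mixed-ratio-⟶ : ∀ e l j → (λ n → ratio (mixed l j (n / suc k ℕ.+ e) r) (choose n r)) ⟶ Δ l j
    mixed-ratio-⟶ e zero    j = choose-ratio-⟶ k j e r
    mixed-ratio-⟶ e (suc l) j =
      ⟶-eventually r (λ n r≤n → sym (denominator (choose n r) (k≤n⇒0<choose r≤n) (mixed-suc l j (m n) r)))
        (⟶-- (mixed-ratio-⟶ e l (suc j)) (mixed-ratio-⟶ e l j))
      where
      m = λ n → n / suc k ℕ.+ e
      denominator : ∀ {x y z} c → 1 ℕ.≤ c → x ℕ.+ y ≡ z → ratio x c ≡ ratio z c - ratio y c
      denominator {x} {y} {z} (suc c) _ = ratio-∸ x y z c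

module ClosedForm where

  open import Data.Nat as ℕ using (ℕ; zero; suc; _∸_)
  import Data.Nat.Properties as ℕP
  open import Data.Nat.Combinatorics using (_C_; nCk≡nC[n∸k])
  import Data.Integer as ℤ
  open import Data.Rational
  open import Data.Rational.Properties
  open import Data.Rational.Solver using (module +-*-Solver)
  open import Data.List using (applyUpTo; foldr)
  open import Function using (_∘_; id)
  open import Relation.Binary.PropositionalEquality
  open import Defs using (ratio; _^ℚ_; sgn; term; etaFormula)
  open Binomial
  open RationalArithmetic
  open InclusionExclusion using (power; Δ)
  open +-*-Solver

  sumℚ : ℕ → (ℕ → ℚ) → ℚ
  sumℚ zero    h = 0ℚ
  sumℚ (suc n) h = h 0 + sumℚ n (h ∘ suc)

  sumℚ-cong : ∀ n {h h′ : ℕ → ℚ} → (∀ i → i ℕ.< n → h i ≡ h′ i) → sumℚ n h ≡ sumℚ n h′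
  sumℚ-cong zero    e = refl
  sumℚ-cong (suc n) e = cong₂ _+_ (e 0 (ℕ.s≤s ℕ.z≤n)) (sumℚ-cong n (λ i i<n → e (suc i) (ℕ.s≤s i<n)))

  sumℚ-+ : ∀ n (h h′ : ℕ → ℚ) → sumℚ n (λ i → h i + h′ i) ≡ sumℚ n h + sumℚ n h′
  sumℚ-+ zero    h h′ = refl
  sumℚ-+ (suc n) h h′ = trans (cong (h 0 + h′ 0 +_) (sumℚ-+ n (h ∘ suc) (h′ ∘ suc)))
    (solve 4 (λ a b c d → a :+ b :+ (c :+ d) := a :+ c :+ (b :+ d)) refl
      (h 0) (h′ 0) (sumℚ n (h ∘ suc)) (sumℚ n (h′ ∘ suc)))

  sumℚ-neg : ∀ n (h : ℕ → ℚ) → sumℚ n (λ i → - h i) ≡ - sumℚ n h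
  sumℚ-neg zero    h = refl
  sumℚ-neg (suc n) h = trans (cong (- h 0 +_) (sumℚ-neg n (h ∘ suc)))
    (solve 2 (λ a b → :- a :+ :- b := :- (a :+ b)) refl (h 0) (sumℚ n (h ∘ suc)))

  sumℚ-suc : ∀ n (h : ℕ → ℚ) → sumℚ (suc n) h ≡ sumℚ n h + h n
  sumℚ-suc zero    h = trans (+-identityʳ (h 0)) (sym (+-identityˡ (h 0)))
  sumℚ-suc (suc n) h = trans (cong (h 0 +_) (sumℚ-suc n (h ∘ suc))) (sym (+-assoc (h 0) _ (h (suc n))))

  foldr-applyUpTo : ∀ (h : ℕ → ℚ) n (f : ℕ → ℕ) →
    foldr (λ i acc → h i + acc) 0ℚ (applyUpTo f n) ≡ sumℚ n (h ∘ f)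
  foldr-applyUpTo h zero    f = refl
  foldr-applyUpTo h (suc n) f = cong (h (f 0) +_) (foldr-applyUpTo h n (f ∘ suc))

  alternating : ℕ → ℚ
  alternating zero    = 1ℚ
  alternating (suc i) = - alternating i

  sgn≡alternating : ∀ i → sgn i ≡ alternating i
  sgn≡alternating zero          = refl
  sgn≡alternating (suc zero)    = refl
  sgn≡alternating (suc (suc i)) =
    trans (sgn≡alternating i) (sym (solve 1 (λ a → :- (:- a) := a) refl (alternating i)))

  module _ (k r : ℕ) where

    binomialSum : ℕ → ℕ → ℚ
    binomialSum l j = sumℚ (suc l) (λ i → alternating i * toℚ (choose l i) * power k r (j ℕ.+ (l ∸ i)))

    -- Split each coefficient by Pascal's rule; the two halves are the sums at j + 1 and at j.
    binomialSum-suc : ∀ l j → binomialSum (suc l) j ≡ binomialSum l (suc j) - binomialSum l j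
    binomialSum-suc l j = begin
      t 0 + sumℚ (suc l) (t ∘ suc)
        ≡⟨ cong (t 0 +_) (trans (sumℚ-cong (suc l) (λ i _ → pascal i)) (sumℚ-+ (suc l) (λ i → - a i) b)) ⟩
      t 0 + (sumℚ (suc l) (λ i → - a i) + sumℚ (suc l) b)
        ≡⟨ cong₂ (λ x y → t 0 + (x + y)) (sumℚ-neg (suc l) a) (trans (sumℚ-suc l b) (cong (sumℚ l b +_) b-last)) ⟩
      t 0 + (- binomialSum l j + (sumℚ l b + 0ℚ))
        ≡⟨ solve 3 (λ t s b → t :+ (:- s :+ (b :+ con 0ℚ)) := (t :+ b) :- s) refl (t 0) (binomialSum l j) (sumℚ l b) ⟩
      (t 0 + sumℚ l b) - binomialSum l j
        ≡⟨ cong (_- binomialSum l j) (sym (cong₂ _+_ first (sumℚ-cong l shifted))) ⟩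
      binomialSum l (suc j) - binomialSum l j ∎
      where
      open ≡-Reasoning
      t a b : ℕ → ℚ
      t i = alternating i * toℚ (choose (suc l) i) * power k r (j ℕ.+ (suc l ∸ i))
      a i = alternating i * toℚ (choose l i) * power k r (j ℕ.+ (l ∸ i))
      b i = alternating (suc i) * toℚ (choose l (suc i)) * power k r (j ℕ.+ (l ∸ i))
      pascal : ∀ i → t (suc i) ≡ - a i + b i
      pascal i = trans (cong (λ z → - alternating i * z * power k r (j ℕ.+ (l ∸ i))) (toℚ-+ (choose l i) (choose l (suc i))))
        (solve 4 (λ s x y g → :- s :* (x :+ y) :* g := :- (s :* x :* g) :+ :- s :* y :* g) refl
          (alternating i) (toℚ (choose l i)) (toℚ (choose l (suc i))) (power k r (j ℕ.+ (l ∸ i))))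
      b-last : b l ≡ 0ℚ
      b-last = trans (cong (λ z → alternating (suc l) * toℚ z * power k r (j ℕ.+ (l ∸ l))) (n<k⇒choose≡0 (ℕP.n<1+n l)))
        (trans (cong (_* power k r (j ℕ.+ (l ∸ l))) (*-zeroʳ (alternating (suc l)))) (*-zeroˡ (power k r (j ℕ.+ (l ∸ l)))))
      first : alternating 0 * toℚ (choose l 0) * power k r (suc j ℕ.+ (l ∸ 0)) ≡ t 0
      first = cong (λ z → alternating 0 * toℚ 1 * power k r z) (sym (ℕP.+-suc j l))
      shifted : ∀ i → i ℕ.< l →
        alternating (suc i) * toℚ (choose l (suc i)) * power k r (suc j ℕ.+ (l ∸ suc i)) ≡ b i
      shifted i i<l = cong (λ z → alternating (suc i) * toℚ (choose l (suc i)) * power k r z)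
        (sym (trans (cong (j ℕ.+_) (ℕP.+-∸-assoc 1 i<l)) (ℕP.+-suc j (l ∸ suc i))))

    Δ≡binomialSum : ∀ l j → Δ k r l j ≡ binomialSum l j
    Δ≡binomialSum zero    j = sym (trans (+-identityʳ _) (trans (*-identityˡ _) (cong (power k r) (ℕP.+-identityʳ j))))
    Δ≡binomialSum (suc l) j = trans (cong₂ _-_ (Δ≡binomialSum l (suc j)) (Δ≡binomialSum l j)) (sym (binomialSum-suc l j))

  1^ℚ : ∀ r → 1ℚ ^ℚ r ≡ 1ℚ
  1^ℚ zero    = refl
  1^ℚ (suc r) = trans (*-identityˡ (1ℚ ^ℚ r)) (1^ℚ r)

  -- The i = 0 term of the binomial sum is 1, the i = K term vanishes as r ≥ 1,
  -- and C(K, i) = C(K, K − i).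
  1-Δ≡etaFormula : ∀ k r → 1ℚ - Δ k (suc r) (suc k) 0 ≡ etaFormula (suc r) k
  1-Δ≡etaFormula k r = begin
    1ℚ - Δ k (suc r) K 0
      ≡⟨ cong (λ z → 1ℚ - z) (Δ≡binomialSum k (suc r) K 0) ⟩
    1ℚ - (s 0 + sumℚ K (s ∘ suc))
      ≡⟨ cong (λ z → 1ℚ - (z + sumℚ K (s ∘ suc))) s-first ⟩
    1ℚ - (1ℚ + sumℚ K (s ∘ suc))
      ≡⟨ cong (λ z → 1ℚ - (1ℚ + z)) (trans (sumℚ-suc k (s ∘ suc)) (cong (sumℚ k (s ∘ suc) +_) s-last)) ⟩
    1ℚ - (1ℚ + (sumℚ k (s ∘ suc) + 0ℚ))
      ≡⟨ solve 1 (λ x → con 1ℚ :- (con 1ℚ :+ (x :+ con 0ℚ)) := :- x) refl (sumℚ k (s ∘ suc)) ⟩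
    - sumℚ k (s ∘ suc)
      ≡⟨ sumℚ-neg k (s ∘ suc) ⟨
    sumℚ k (λ i → - s (suc i))
      ≡⟨ sumℚ-cong k (λ i i<k → sym (term≡ i i<k)) ⟩
    sumℚ k (λ i → term (suc r) k (suc i))
      ≡⟨ foldr-applyUpTo (λ i → term (suc r) k (suc i)) k id ⟨
    etaFormula (suc r) k ∎
    where
    open ≡-Reasoning
    K = suc k
    s : ℕ → ℚ
    s i = alternating i * toℚ (choose K i) * power k (suc r) (0 ℕ.+ (K ∸ i))
    s-first : s 0 ≡ 1ℚ
    s-first = trans (*-identityˡ (power k (suc r) K)) (trans (cong (_^ℚ suc r) (ratio-self k)) (1^ℚ (suc r)))
    s-last : s K ≡ 0ℚ
    s-last = trans (cong (alternating K * toℚ (choose K K) *_)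
        (trans (cong (λ z → ratio z K ^ℚ suc r) (ℕP.n∸n≡0 K))
          (trans (cong (_* (ratio 0 K ^ℚ r)) (ratio-zero k)) (*-zeroˡ (ratio 0 K ^ℚ r)))))
      (*-zeroʳ (alternating K * toℚ (choose K K)))
    term≡ : ∀ i → i ℕ.< k → term (suc r) k (suc i) ≡ - s (suc i)
    term≡ i i<k = trans (cong₂ _*_ sign (cong (_* power k (suc r) (K ∸ suc i)) coefficient))
      (solve 3 (λ a b x → a :* (b :* x) := :- (:- a :* b :* x)) refl
        (alternating i) (toℚ (choose K (suc i))) (power k (suc r) (K ∸ suc i)))
      where
      sign : sgn (suc i ℕ.+ 1) ≡ alternating i
      sign = trans (cong (λ z → sgn (suc z)) (ℕP.+-comm i 1)) (sgn≡alternating i)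
      coefficient : ℤ.+ (K C (K ∸ suc i)) / 1 ≡ toℚ (choose K (suc i))
      coefficient = trans (ratio-1 (K C (K ∸ suc i)))
        (cong toℚ (sym (trans (choose≡C K (suc i)) (nCk≡nC[n∸k] (ℕ.s≤s (ℕP.<⇒≤ i<k))))))

module Extremal where

  open import Data.Nat
  open import Data.Nat.Properties
  open import Data.Nat.ListAction using (sum)
  open import Data.List using (tabulate; replicate)
  open import Data.List.Properties using (length-tabulate)
  open import Data.Sum using (inj₂)
  open import Data.Product using (∃; _×_; _,_)
  open import Function using (_∘_)
  open import Relation.Binary.PropositionalEquality
  open import Defs using (Labelling; edges; IsEta)
  open Binomial
  open Transversals
  open Smoothing using (transversals-≤-balanced)
  open Hitting using (sizes; sum-sizes)
  open EdgeCount
  open BalancedColouring using (balanced)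
  open InclusionExclusion using (mixed; mixed-transversals; Δ; mixed-ratio-⟶)
  open Limits using (_⟶_)
  open import Defs using (ratio)

  -- Non-edges of the partition of n vertices into k + 1 parts of size ⌊n/K⌋ + e.
  uniform : ℕ → ℕ → ℕ → ℕ → ℕ
  uniform k n e r = mixed (suc k) 0 (n / suc k + e) r

  uniform-⟶ : ∀ k r e → (λ n → ratio (uniform k n e r) (choose n r)) ⟶ Δ k r (suc k) 0
  uniform-⟶ k r e = mixed-ratio-⟶ k r e (suc k) 0

  choose≤edges+uniform : ∀ {n k} (c : Labelling n 0 k) r → choose n r ≤ edges c r + uniform k n 1 r
  choose≤edges+uniform {n} {k} c r = begin
    choose n r                                                 ≡⟨ edges+transversals c r ⟨
    edges c r + transversals (tabulate (sizes (colour ∘ c))) r ≤⟨ +-monoʳ-≤ (edges c r) smoothed ⟩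
    edges c r + uniform k n 1 r                                ∎
    where
    open ≤-Reasoning
    parts = tabulate (sizes (colour ∘ c))
    smoothed : transversals parts r ≤ uniform k n 1 r
    smoothed = begin
      transversals parts r
        ≤⟨ transversals-≤-balanced (suc k) parts (length-tabulate (sizes (colour ∘ c))) r ⟩
      transversals (replicate (suc k) (suc (sum parts / suc k))) r
        ≡⟨ cong (λ x → transversals (replicate (suc k) (suc (x / suc k))) r) (sum-sizes (colour ∘ c)) ⟩
      transversals (replicate (suc k) (suc (n / suc k))) r
        ≡⟨ cong (λ x → transversals (replicate (suc k) x) r) (+-comm 1 (n / suc k)) ⟩
      transversals (replicate (suc k) (n / suc k + 1)) r
        ≡⟨ mixed-transversals (suc k) (n / suc k + 1) r ⟨
      uniform k n 1 r ∎

  balanced-edges : ∀ n k r → ∃ λ (c : Labelling n 0 k) → edges c r + uniform k n 0 r ≤ choose n r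
  balanced-edges n k r with balanced k n
  ... | col , large = inj₂ ∘ col , (begin
    edges c r + uniform k n 0 r
      ≡⟨ cong (λ x → edges c r + mixed (suc k) 0 x r) (+-identityʳ (n / suc k)) ⟩
    edges c r + mixed (suc k) 0 (n / suc k) r
      ≡⟨ cong (edges c r +_) (mixed-transversals (suc k) (n / suc k) r) ⟩
    edges c r + transversals (replicate (suc k) (n / suc k)) r
      ≤⟨ +-monoʳ-≤ (edges c r) (transversals-mono-≤ large r) ⟩
    edges c r + transversals (tabulate (sizes col)) r
      ≡⟨ edges+transversals c r ⟩
    choose n r ∎)
    where
    open ≤-Reasoning
    c : Labelling n 0 k
    c = inj₂ ∘ col

  eta-bounds : ∀ {r n k m} → IsEta r n 0 k m →
    m + uniform k n 0 r ≤ choose n r × choose n r ≤ m + uniform k n 1 r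
  eta-bounds {r} {n} {k} ((c₁ , edges≡m) , minimal) with balanced-edges n k r
  ... | c₀ , bound =
    ≤-trans (+-monoˡ-≤ (uniform k n 0 r) (minimal c₀)) bound ,
    subst (λ x → choose n r ≤ x + uniform k n 1 r) edges≡m (choose≤edges+uniform c₁ r)

module Sandwich where

  open import Data.Nat as ℕ using (suc)
  open import Data.Rational
  open import Data.Rational.Properties
  open import Data.Rational.Solver using (module +-*-Solver)
  open import Data.Sum using (inj₁; inj₂)
  open import Relation.Binary.PropositionalEquality
  open import Defs using (ratio)
  open RationalArithmetic
  open +-*-Solver

  p≤∣p∣ : ∀ p → p ≤ ∣ p ∣
  p≤∣p∣ p with ∣p∣≡p∨∣p∣≡-p p
  ... | inj₁ ∣p∣≡p  = ≤-reflexive (sym ∣p∣≡p)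
  ... | inj₂ ∣p∣≡-p = ≤-trans p≤0 (0≤∣p∣ p)
    where
    p≤0 : p ≤ 0ℚ
    p≤0 = subst₂ _≤_ (+-identityʳ p) (+-inverseʳ p) (+-monoʳ-≤ p (subst (0ℚ ≤_) ∣p∣≡-p (0≤∣p∣ p)))

  -p≤∣p∣ : ∀ p → - p ≤ ∣ p ∣
  -p≤∣p∣ p = subst (- p ≤_) (∣-p∣≡∣p∣ p) (p≤∣p∣ (- p))

  between-within : ∀ {a x b y ε} → a ≤ x → x ≤ b → ∣ a - y ∣ < ε → ∣ b - y ∣ < ε → ∣ x - y ∣ < ε
  between-within {a} {x} {b} {y} {ε} a≤x x≤b a-close b-close with ∣p∣≡p∨∣p∣≡-p (x - y)
  ... | inj₁ e = subst (_< ε) (sym e) (≤-<-trans (+-monoˡ-≤ (- y) x≤b) (≤-<-trans (p≤∣p∣ (b - y)) b-close))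
  ... | inj₂ e = subst (_< ε) (sym e) (≤-<-trans below (≤-<-trans (-p≤∣p∣ (a - y)) a-close))
    where
    below : - (x - y) ≤ - (a - y)
    below = neg-antimono-≤ (+-monoˡ-≤ (- y) a≤x)

  ∣[1-p]-[1-q]∣≡∣p-q∣ : ∀ p q → ∣ (1ℚ - p) - (1ℚ - q) ∣ ≡ ∣ p - q ∣
  ∣[1-p]-[1-q]∣≡∣p-q∣ p q = trans
    (cong ∣_∣ (solve 2 (λ p q → (con 1ℚ :- p) :- (con 1ℚ :- q) := :- (p :- q)) refl p q))
    (∣-p∣≡∣p∣ (p - q))

  x+y≤1⇒x≤1-y : ∀ {x y} → x + y ≤ 1ℚ → x ≤ 1ℚ - y
  x+y≤1⇒x≤1-y {x} {y} h = subst (_≤ 1ℚ - y) (solve 2 (λ x y → x :+ y :- y := x) refl x y) (+-monoˡ-≤ (- y) h)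

  1≤x+y⇒1-y≤x : ∀ {x y} → 1ℚ ≤ x + y → 1ℚ - y ≤ x
  1≤x+y⇒1-y≤x {x} {y} h = subst (1ℚ - y ≤_) (solve 2 (λ x y → x :+ y :- y := x) refl x y) (+-monoˡ-≤ (- y) h)

  ratio-squeezed : ∀ {m g₀ g₁ T L ε} → 1 ℕ.≤ T → m ℕ.+ g₀ ℕ.≤ T → T ℕ.≤ m ℕ.+ g₁ →
    ∣ ratio g₀ T - L ∣ < ε → ∣ ratio g₁ T - L ∣ < ε → ∣ ratio m T - (1ℚ - L) ∣ < ε
  ratio-squeezed {m} {g₀} {g₁} {suc t} {L} {ε} _ upper lower g₀-close g₁-close =
    between-within {1ℚ - ratio g₁ (suc t)} {ratio m (suc t)} {1ℚ - ratio g₀ (suc t)}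
      (1≤x+y⇒1-y≤x {ratio m (suc t)} (≤-trans (≤-reflexive (sym (ratio-self t)))
        (≤-trans (ratio-mono-≤ t lower) (≤-reflexive (sym (ratio-+ m g₁ t))))))
      (x+y≤1⇒x≤1-y {ratio m (suc t)} (≤-trans (≤-reflexive (ratio-+ m g₀ t))
        (≤-trans (ratio-mono-≤ t upper) (≤-reflexive (ratio-self t)))))
      (subst (_< ε) (sym (∣[1-p]-[1-q]∣≡∣p-q∣ (ratio g₁ (suc t)) L)) g₁-close)
      (subst (_< ε) (sym (∣[1-p]-[1-q]∣≡∣p-q∣ (ratio g₀ (suc t)) L)) g₀-close)

open import Defs
open import Data.Nat using (ℕ; _≤_; _≥_)
open import Data.Nat.Combinatorics using (_C_)
open import Data.Product using (Σ)
open import Data.Rational using (ℚ; 0ℚ; _<_; _-_; ∣_∣)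

open import Data.Nat using (zero; suc; _⊔_)
open import Data.Nat.Properties using (m⊔n≤o⇒m≤o; m⊔n≤o⇒n≤o)
open import Data.Product using (_,_; proj₁; proj₂)
open import Relation.Binary.PropositionalEquality using (subst₂)
open Binomial using (choose≡C; k≤n⇒0<choose)
open Limits using (⟶⇒within)
open ClosedForm using (1-Δ≡etaFormula)
open Extremal using (eta-bounds; uniform-⟶)
open Sandwich using (ratio-squeezed)

proposition3p5 : (r k : ℕ) → 3 ≤ r → 2 ≤ k → k ≤ r Data.Nat.∸ 1 →
    (ε : ℚ) → 0ℚ < ε →
    Σ ℕ (λ N → (n : ℕ) → n ≥ N → (m : ℕ) → IsEta r n 0 k m →
    ∣ ratio m (n C r) - etaFormula r k ∣ < ε)
proposition3p5 zero    k () _ _ _ _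
proposition3p5 (suc r) k _  _ _ ε ε>0 = N₀ ⊔ N₁ ⊔ suc r , close
  where
  uniform-within = λ e → ⟶⇒within (uniform-⟶ k (suc r) e) ε ε>0
  N₀ = proj₁ (uniform-within 0)
  N₁ = proj₁ (uniform-within 1)
  close : (n : ℕ) → n ≥ N₀ ⊔ N₁ ⊔ suc r → (m : ℕ) → IsEta (suc r) n 0 k m →
    ∣ ratio m (n C suc r) - etaFormula (suc r) k ∣ < ε
  close n n≥N m eta = subst₂ (λ T L → ∣ ratio m T - L ∣ < ε) (choose≡C n (suc r)) (1-Δ≡etaFormula k r)
    (ratio-squeezed (k≤n⇒0<choose (m⊔n≤o⇒n≤o (N₀ ⊔ N₁) (suc r) n≥N))
      (proj₁ (eta-bounds eta)) (proj₂ (eta-bounds eta))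
      (proj₂ (uniform-within 0) n (m⊔n≤o⇒m≤o N₀ N₁ (m⊔n≤o⇒m≤o (N₀ ⊔ N₁) (suc r) n≥N)))
      (proj₂ (uniform-within 1) n (m⊔n≤o⇒n≤o N₀ N₁ (m⊔n≤o⇒m≤o (N₀ ⊔ N₁) (suc r) n≥N))))
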